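{- Let $n$ be a positive integer and let $\mu=(q,q-1,q-2,\dots,p)$ for integers $q\ge p>0$ with $q-p+1\le n$. Then \[ B_\mu=2^{\ell(\mu)}\sum_\lambda(-1)^{\mathsf{cols}(\lambda/\mu)}(-\beta/2)^{|\lambda/\mu|}A_\lambda, \] where the sum is over strict partitions $\lambda\supseteq\mu$ with $\ell(\lambda)=\ell(\mu)$ such that $\mathsf{SD}_{\lambda/\mu}$ is a vertical strip (all partitions regarded as vectors in $\mathbb{N}^n$ by appending zeros).
   Context: Let $\beta,x_1,\dots,x_n$ be commuting indeterminates; $x\oplus y:=x+y+\beta xy$ and $x\ominus y:=\frac{x-y}{1+\beta y}$. For a nonzero $\lambda\in\mathbb{N}^n$ let $r:=\max\{i:\lambda_i\ne0\}$, $x^\lambda=\prod_i x_i^{\lambda_i}$, and define the rational functions $A_\lambda:=\frac1{r!}\sum_{w\in S_r}w\Big(x^\lambda\prod_{i=1}^r\prod_{j=i+1}^n\frac{x_i\oplus x_j}{x_i\ominus x_j}\Big)$ and $B_\lambda:=\frac1{r!}\sum_{w\in S_r}w\Big(x^\lambda\prod_{i=1}^r(2+\beta x_i)\prod_{j=i+1}^n\frac{x_i\oplus x_j}{x_i\ominus x_j}\Big)$, where $S_r$ acts by permuting $x_1,\dots,x_r$ and fixing $\beta$ and the other variables. A strict partition is a finite strictly decreasing sequence of positive integers, $\ell(\lambda)$ its number of parts; $\mathsf{SD}_\lambda=\{(i,j)\in\mathbb{Z}^2:0<i\le j<i+\lambda_i\}$; $\mu\subseteq\lambda$ means $\mu_i\le\lambda_i$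 for all $i$, $\mathsf{SD}_{\lambda/\mu}=\mathsf{SD}_\lambda\setminus\mathsf{SD}_\mu$, $|\lambda/\mu|=|\mathsf{SD}_{\lambda/\mu}|$, $\mathsf{cols}(\lambda/\mu)$ the number of distinct columns $j$ meeting $\mathsf{SD}_{\lambda/\mu}$; vertical strip = at most one box in each row. -}

module Defs where

open import Data.Bool using (Bool; true; false; _∧_; _∨_; not; if_then_else_; T)
open import Data.Nat as ℕ using (ℕ; zero; suc; _∸_; _!)
import Data.Nat.Properties as ℕP
open import Data.Fin as Fin using (Fin; toℕ)
import Data.Fin.Properties as FinP
open import Data.Vec as Vec using (Vec; []; _∷_; lookup; tabulate)
open import Data.List as List using (List; []; _∷_; filterᵇ; allFin; upTo; concatMap; applyUpTo)
import Data.Rational as ℚ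
open import Data.Rational using (ℚ; 0ℚ; 1ℚ; _+_; _*_; _-_; -_; 1/_; ≢-nonZero)
open import Data.Rational.Properties using (_≟_)
open import Relation.Nullary.Decidable using (does; yes; no)
import Relation.Nullary
import Data.Integer
open import Data.Bool.ListAction using (and; or)
open import Data.Nat.ListAction renaming (sum to sumℕ)
open import Relation.Binary.PropositionalEquality using (_≡_; _≢_)

-- total division (value 0 when the denominator is 0; only used under
-- hypotheses guaranteeing nonzero denominators)
_÷'_ : ℚ → ℚ → ℚ
p ÷' q = div p q (q ≟ 0ℚ)
  where
  div : (p q : ℚ) → Relation.Nullary.Dec (q ≡ 0ℚ) → ℚ
  div p q (yes _) = 0ℚ
  div p q (no q≢0) = p * (1/ q) {{≢-nonZero q≢0}}

infixl 7 _÷'_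

pow : ℚ → ℕ → ℚ
pow x zero = 1ℚ
pow x (suc k) = x * pow x k

fromℕ : ℕ → ℚ
fromℕ k = Data.Integer.+ k ℚ./ 1

sumℚ : {A : Set} → List A → (A → ℚ) → ℚ
sumℚ xs f = List.foldr (λ a s → f a + s) 0ℚ xs

prodℚ : {A : Set} → List A → (A → ℚ) → ℚ
prodℚ xs f = List.foldr (λ a s → f a * s) 1ℚ xs

oplus : ℚ → ℚ → ℚ → ℚ
oplus β x y = x + y + β * x * y

ominus : ℚ → ℚ → ℚ → ℚ
ominus β x y = (x - y) ÷' (1ℚ + β * y)

-- Exponent vectors λ ∈ ℕⁿ  (index i : Fin n stands for the 1-based index toℕ i + 1)

maxNZ : ∀ {n} → Vec ℕ n → ℕ
maxNZ {n} lam = List.foldr ℕ._⊔_ 0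
  (List.map (λ i → if does (lookup lam i ℕ.≟ 0) then 0 else suc (toℕ i)) (allFin n))

mono : ∀ {n} → (Fin n → ℚ) → Vec ℕ n → ℚ
mono {n} x lam = prodℚ (allFin n) (λ i → pow (x i) (lookup lam i))

allFuns : (k n : ℕ) → List (Vec (Fin n) k)
allFuns zero n = [] ∷ []
allFuns (suc k) n = concatMap (λ v → List.map (λ a → a ∷ v) (allFin n)) (allFuns k n)

injectiveᵇ : ∀ {n} → Vec (Fin n) n → Bool
injectiveᵇ {n} w = and (List.map (λ i → and (List.map (λ j →
  does (i Fin.≟ j) ∨ not (does (lookup w i Fin.≟ lookup w j))) (allFin n))) (allFin n))

fixesFromᵇ : ∀ {n} → ℕ → Vec (Fin n) n → Bool
fixesFromᵇ {n} r w = and (List.map (λ i →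
  does (toℕ i ℕ.<? r) ∨ does (lookup w i Fin.≟ i)) (allFin n))

-- S_r as the permutations of Fin n fixing every index ≥ r (0-based),
-- i.e. permuting x_1,…,x_r and fixing the others; each listed exactly once.
Sym : (n r : ℕ) → List (Vec (Fin n) n)
Sym n r = filterᵇ (λ w → injectiveᵇ w ∧ fixesFromᵇ r w) (allFuns n n)

act : ∀ {n} → Vec (Fin n) n → ((Fin n → ℚ) → ℚ) → (Fin n → ℚ) → ℚ
act w f x = f (λ i → x (lookup w i))

kernel : ∀ {n} → ℚ → ℕ → (Fin n → ℚ) → ℚ
kernel {n} β r x = prodℚ (allFin n) (λ i → prodℚ (allFin n) (λ j →
  if does (toℕ i ℕ.<? r) ∧ does (toℕ i ℕ.<? toℕ j)
  then oplus β (x i) (x j) ÷' ominus β (x i) (x j) else 1ℚ))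

symmetrize : ∀ {n} → ℕ → ((Fin n → ℚ) → ℚ) → (Fin n → ℚ) → ℚ
symmetrize {n} r f x = sumℚ (Sym n r) (λ w → act w f x) ÷' fromℕ (r !)

A : ∀ {n} → ℚ → Vec ℕ n → (Fin n → ℚ) → ℚ
A β lam = symmetrize (maxNZ lam) (λ y → mono y lam * kernel β (maxNZ lam) y)

B : ∀ {n} → ℚ → Vec ℕ n → (Fin n → ℚ) → ℚ
B {n} β lam = symmetrize (maxNZ lam) (λ y → mono y lam
  * prodℚ (allFin n) (λ i → if does (toℕ i ℕ.<? maxNZ lam)
                           then fromℕ 2 + β * y i else 1ℚ)
  * kernel β (maxNZ lam) y)

-- strict partition: λ_{i+1} > 0 implies λ_i > λ_{i+1} (so positive parts
-- strictly decrease and are followed only by zeros)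
isStrictᵇ : ∀ {n} → Vec ℕ n → Bool
isStrictᵇ {n} lam = and (List.map (λ i → and (List.map (λ j →
  not (does (suc (toℕ i) ℕ.≟ toℕ j)) ∨ does (lookup lam j ℕ.≟ 0)
    ∨ does (lookup lam j ℕ.<? lookup lam i)) (allFin n))) (allFin n))

len : ∀ {n} → Vec ℕ n → ℕ
len {n} lam = List.length (filterᵇ (λ i → not (does (lookup lam i ℕ.≟ 0))) (allFin n))

subᵇ : ∀ {n} → Vec ℕ n → Vec ℕ n → Bool
subᵇ {n} mu lam = and (List.map (λ i → does (lookup mu i ℕ.≤? lookup lam i)) (allFin n))

inSDᵇ : ∀ {n} → Vec ℕ n → Fin n → ℕ → Bool
inSDᵇ lam i j = does (suc (toℕ i) ℕ.≤? j) ∧ does (j ℕ.<? suc (toℕ i) ℕ.+ lookup lam i)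

inSkewᵇ : ∀ {n} → Vec ℕ n → Vec ℕ n → Fin n → ℕ → Bool
inSkewᵇ lam mu i j = inSDᵇ lam i j ∧ not (inSDᵇ mu i j)

-- column range that contains every column of SD_λ (j < i + λ_i ≤ n + Σ λ)
colBound : ∀ {n} → Vec ℕ n → ℕ
colBound {n} lam = suc (n ℕ.+ Vec.sum lam)

rowCount : ∀ {n} → Vec ℕ n → Vec ℕ n → Fin n → ℕ
rowCount lam mu i = List.length (filterᵇ (inSkewᵇ lam mu i) (upTo (colBound lam)))

skewSize : ∀ {n} → Vec ℕ n → Vec ℕ n → ℕ
skewSize {n} lam mu = sumℕ (List.map (rowCount lam mu) (allFin n))

cols : ∀ {n} → Vec ℕ n → Vec ℕ n → ℕ
cols {n} lam mu = List.length (filterᵇ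
  (λ j → or (List.map (λ i → inSkewᵇ lam mu i j) (allFin n)))
  (upTo (colBound lam)))

verticalStripᵇ : ∀ {n} → Vec ℕ n → Vec ℕ n → Bool
verticalStripᵇ {n} lam mu = and (List.map (λ i → does (rowCount lam mu i ℕ.≤? 1)) (allFin n))

validᵇ : ∀ {n} → Vec ℕ n → Vec ℕ n → Bool
validᵇ mu lam = isStrictᵇ lam ∧ subᵇ mu lam ∧ does (len lam ℕ.≟ len mu)
  ∧ verticalStripᵇ lam mu

boxVecs : (n b : ℕ) → List (Vec ℕ n)
boxVecs zero b = [] ∷ []
boxVecs (suc n) b = concatMap (λ v → List.map (λ a → a ∷ v) (upTo (suc b))) (boxVecs n b)

-- the index set of the sum: all λ satisfying the condition.  Any such λ
-- has λ_i ≤ μ_i + 1 (vertical strip), so entries ≤ max μ + 1 ≤ Σ μ + 1 suffices.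
summands : ∀ {n} → Vec ℕ n → List (Vec ℕ n)
summands {n} mu = filterᵇ (validᵇ mu) (boxVecs n (suc (Vec.sum mu)))

staircase : (n q p : ℕ) → Vec ℕ n
staircase n q p = tabulate (λ i → if does (toℕ i ℕ.<? suc (q ∸ p)) then q ∸ toℕ i else 0)

-- Let r = ℓ(μ) = q - p + 1 and t = -β/2. The strict λ ⊇ μ of length r for which SD_{λ/μ} is a
-- vertical strip are exactly μ + (1,…,1,0,…,0) with k ones, 0 ≤ k ≤ r, and for k ≥ 1 the new boxes
-- all lie in one column; so the right-hand side is 2^r (A_μ - Σ_{k=1}^{r} t^k A_{μ+(1^k)}).
-- Both A and B symmetrise, over S_r, a monomial times the kernel ∏ (x_i ⊕ x_j)/(x_i ⊖ x_j), and
-- 2 + βx_i = 2(1 - t x_i). Exchanging x_a and x_{a+1} (a + 1 < r) turns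
-- (x_a ⊕ x_{a+1})/(x_a ⊖ x_{a+1}) · (1 + βx_a) into its negative, so the symmetrisation of
-- g · (1 + βx_a) vanishes whenever g is symmetric in x_a and x_{a+1}. As consecutive parts of μ
-- differ by exactly one, this relation allows ∏_{i ≤ r} (1 - t x_i) x^μ to be expanded one factor
-- at a time, and the expansion telescopes to the right-hand side.
{-# OPTIONS --safe #-}
module Submission where

open import Algebra.Bundles using (CommutativeSemigroup)
open import Algebra.Structures using (IsCommutativeMonoid)
open import Data.Bool using (Bool; true; false; if_then_else_; _∧_; _∨_; not)
open import Data.Bool.ListAction using (and; or)
open import Data.Empty using (⊥; ⊥-elim)
open import Data.Fin as Fin using (Fin; toℕ; fromℕ<)
import Data.Fin.Properties as FinP
open import Data.List as List using (List; []; _∷_; _++_; map; concatMap; filterᵇ; allFin; upTo; applyUpTo; foldr; length)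
open import Data.Nat as ℕ using (ℕ; zero; suc; _<_; _≤_; _∸_; z≤n; s≤s; z<s; s<s)
import Data.Nat.Properties as ℕP
open import Data.Product using (Σ; ∃; _×_; _,_; proj₁; proj₂)
open import Data.Rational as ℚ using (ℚ; 0ℚ; 1ℚ)
import Data.Rational.Properties as ℚP
open import Data.Sum using (_⊎_; inj₁; inj₂)
open import Data.Vec as Vec using (Vec; []; _∷_; lookup; tabulate)
open import Data.Rational.Solver using (module +-*-Solver)
open +-*-Solver using (solve; _:=_; _:+_; _:*_; _:-_; :-_; con)
import Data.List.Properties as ListP
import Data.Vec.Properties as VecP
open import Function using (_∘_; id)
open import Relation.Binary using (tri<; tri≈; tri>)
open import Relation.Binary.PropositionalEquality
open import Relation.Nullary using (¬_; Dec; yes; no; does; _because_; ofʸ; ofⁿ)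
open import Relation.Nullary.Decidable using (dec-true; dec-false)

open import Defs

module BoolReflection where

  if-true : ∀ {A : Set} (b : Bool) {x y : A} → b ≡ true → (if b then x else y) ≡ x
  if-true true _ = refl

  if-false : ∀ {A : Set} (b : Bool) {x y : A} → b ≡ false → (if b then x else y) ≡ y
  if-false false _ = refl

  if-∧ : ∀ {A : Set} (b₁ b₂ : Bool) {u d : A} → (if b₁ ∧ b₂ then u else d) ≡ (if b₂ then (if b₁ then u else d) else d)
  if-∧ true true = refl
  if-∧ true false = refl
  if-∧ false true = refl
  if-∧ false false = refl

  bool-ext : ∀ {b c : Bool} → (b ≡ true → c ≡ true) → (c ≡ true → b ≡ true) → b ≡ c
  bool-ext {true} {true} _ _ = refl
  bool-ext {true} {false} f _ = sym (f refl)
  bool-ext {false} {true} _ g = g refl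
  bool-ext {false} {false} _ _ = refl

  ∧-elimˡ : ∀ {b c} → b ∧ c ≡ true → b ≡ true
  ∧-elimˡ {true} _ = refl

  ∧-elimʳ : ∀ {b c} → b ∧ c ≡ true → c ≡ true
  ∧-elimʳ {true} e = e

  ∧-intro : ∀ {b c} → b ≡ true → c ≡ true → b ∧ c ≡ true
  ∧-intro refl refl = refl

  ∧-falseʳ : ∀ (b : Bool) {c} → c ≡ false → b ∧ c ≡ false
  ∧-falseʳ true refl = refl
  ∧-falseʳ false refl = refl

  not-elim : ∀ {b} → not b ≡ true → b ≡ false
  not-elim {false} _ = refl

  not-intro : ∀ {b} → b ≡ false → not b ≡ true
  not-intro refl = refl

  does-true⇒ : ∀ {P : Set} (d : Dec P) → does d ≡ true → P
  does-true⇒ (true because ofʸ p) _ = p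

  does-∨⁻ : ∀ {P Q : Set} (p? : Dec P) (q? : Dec Q) → does p? ∨ does q? ≡ true → P ⊎ Q
  does-∨⁻ (true because ofʸ p) _ _ = inj₁ p
  does-∨⁻ (false because _) (true because ofʸ q) _ = inj₂ q

  does-∨⁺ : ∀ {P Q : Set} (p? : Dec P) (q? : Dec Q) → P ⊎ Q → does p? ∨ does q? ≡ true
  does-∨⁺ (true because _) _ _ = refl
  does-∨⁺ (false because _) (true because _) _ = refl
  does-∨⁺ (false because ofⁿ ¬p) (false because _) (inj₁ p) = ⊥-elim (¬p p)
  does-∨⁺ (false because _) (false because ofⁿ ¬q) (inj₂ q) = ⊥-elim (¬q q)

  does-∨-not⁻ : ∀ {P Q : Set} (p? : Dec P) (q? : Dec Q) → does p? ∨ not (does q?) ≡ true → P ⊎ ¬ Q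
  does-∨-not⁻ (true because ofʸ p) _ _ = inj₁ p
  does-∨-not⁻ (false because _) (false because ofⁿ ¬q) _ = inj₂ ¬q

  does-∨-not⁺ : ∀ {P Q : Set} (p? : Dec P) (q? : Dec Q) → P ⊎ ¬ Q → does p? ∨ not (does q?) ≡ true
  does-∨-not⁺ (true because _) _ _ = refl
  does-∨-not⁺ (false because _) (false because _) _ = refl
  does-∨-not⁺ (false because ofⁿ ¬p) (true because _) (inj₁ p) = ⊥-elim (¬p p)
  does-∨-not⁺ (false because _) (true because ofʸ q) (inj₂ ¬q) = ⊥-elim (¬q q)

  map-allFin : ∀ {A : Set} n (h : Fin n → A) → map h (allFin n) ≡ List.tabulate h
  map-allFin n h = ListP.map-tabulate id h

  and-tabulate⁻ : ∀ n (h : Fin n → Bool) → and (List.tabulate h) ≡ true → ∀ i → h i ≡ true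
  and-tabulate⁻ (suc n) h e Fin.zero = ∧-elimˡ e
  and-tabulate⁻ (suc n) h e (Fin.suc i) = and-tabulate⁻ n (h ∘ Fin.suc) (∧-elimʳ {h Fin.zero} e) i

  and-tabulate⁺ : ∀ n (h : Fin n → Bool) → (∀ i → h i ≡ true) → and (List.tabulate h) ≡ true
  and-tabulate⁺ zero h f = refl
  and-tabulate⁺ (suc n) h f = ∧-intro (f Fin.zero) (and-tabulate⁺ n (h ∘ Fin.suc) (f ∘ Fin.suc))

  or-tabulate⁻ : ∀ n (h : Fin n → Bool) → or (List.tabulate h) ≡ true → ∃ λ i → h i ≡ true
  or-tabulate⁻ (suc n) h e with h Fin.zero in eq
  ... | true = Fin.zero , eq
  ... | false with or-tabulate⁻ n (h ∘ Fin.suc) e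
  ... | i , p = Fin.suc i , p

  or-tabulate⁺ : ∀ n (h : Fin n → Bool) (i : Fin n) → h i ≡ true → or (List.tabulate h) ≡ true
  or-tabulate⁺ (suc n) h Fin.zero e rewrite e = refl
  or-tabulate⁺ (suc n) h (Fin.suc i) e with h Fin.zero
  ... | true = refl
  ... | false = or-tabulate⁺ n (h ∘ Fin.suc) i e

  and-allFin⁻ : ∀ n (h : Fin n → Bool) → and (map h (allFin n)) ≡ true → ∀ i → h i ≡ true
  and-allFin⁻ n h e = and-tabulate⁻ n h (trans (cong and (sym (map-allFin n h))) e)

  and-allFin⁺ : ∀ n (h : Fin n → Bool) → (∀ i → h i ≡ true) → and (map h (allFin n)) ≡ true
  and-allFin⁺ n h f = trans (cong and (map-allFin n h)) (and-tabulate⁺ n h f)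

  or-allFin⁻ : ∀ n (h : Fin n → Bool) → or (map h (allFin n)) ≡ true → ∃ λ i → h i ≡ true
  or-allFin⁻ n h e = or-tabulate⁻ n h (trans (cong or (sym (map-allFin n h))) e)

  or-allFin⁺ : ∀ n (h : Fin n → Bool) (i : Fin n) → h i ≡ true → or (map h (allFin n)) ≡ true
  or-allFin⁺ n h i e = trans (cong or (map-allFin n h)) (or-tabulate⁺ n h i e)

  ≡ᵇ-refl : ∀ a → (a ℕ.≡ᵇ a) ≡ true
  ≡ᵇ-refl zero = refl
  ≡ᵇ-refl (suc a) = ≡ᵇ-refl a

  ≡ᵇ-true⇒≡ : ∀ c a → (c ℕ.≡ᵇ a) ≡ true → c ≡ a
  ≡ᵇ-true⇒≡ c a e = ℕP.≡ᵇ⇒≡ c a (subst Data.Bool.T (sym e) _)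

  ≢⇒≡ᵇ-false : ∀ c a → c ≢ a → (c ℕ.≡ᵇ a) ≡ false
  ≢⇒≡ᵇ-false c a c≢a with c ℕ.≡ᵇ a in e
  ... | true = ⊥-elim (c≢a (≡ᵇ-true⇒≡ c a e))
  ... | false = refl

  <?-true : ∀ {c d} → c < d → does (c ℕ.<? d) ≡ true
  <?-true {c} {d} = dec-true (c ℕ.<? d)

  <?-false : ∀ {c d} → ¬ c < d → does (c ℕ.<? d) ≡ false
  <?-false {c} {d} = dec-false (c ℕ.<? d)

  <?-true⁻ : ∀ {c d} → does (c ℕ.<? d) ≡ true → c < d
  <?-true⁻ {c} {d} = does-true⇒ (c ℕ.<? d)

  ≤?-true : ∀ {c d} → c ≤ d → does (c ℕ.≤? d) ≡ true
  ≤?-true {c} {d} = dec-true (c ℕ.≤? d)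

  ≤?-true⁻ : ∀ {c d} → does (c ℕ.≤? d) ≡ true → c ≤ d
  ≤?-true⁻ {c} {d} = does-true⇒ (c ℕ.≤? d)

module AdjacentTransposition where

  adjSwap : ∀ {n} → ℕ → Fin n → Fin n
  adjSwap {suc n} (suc a) Fin.zero = Fin.zero
  adjSwap {suc n} (suc a) (Fin.suc i) = Fin.suc (adjSwap a i)
  adjSwap {suc (suc n)} zero Fin.zero = Fin.suc Fin.zero
  adjSwap {suc (suc n)} zero (Fin.suc Fin.zero) = Fin.zero
  adjSwap {suc (suc n)} zero (Fin.suc (Fin.suc i)) = Fin.suc (Fin.suc i)
  adjSwap {suc zero} zero i = i

  adjSwap-involutive : ∀ {n} a (i : Fin n) → adjSwap a (adjSwap a i) ≡ i
  adjSwap-involutive {suc n} (suc a) Fin.zero = refl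
  adjSwap-involutive {suc n} (suc a) (Fin.suc i) = cong Fin.suc (adjSwap-involutive a i)
  adjSwap-involutive {suc (suc n)} zero Fin.zero = refl
  adjSwap-involutive {suc (suc n)} zero (Fin.suc Fin.zero) = refl
  adjSwap-involutive {suc (suc n)} zero (Fin.suc (Fin.suc i)) = refl
  adjSwap-involutive {suc zero} zero i = refl

  adjSwap-injective : ∀ {n} a {i j : Fin n} → adjSwap a i ≡ adjSwap a j → i ≡ j
  adjSwap-injective a {i} {j} e =
    trans (sym (adjSwap-involutive a i)) (trans (cong (adjSwap a) e) (adjSwap-involutive a j))

  adjSwapℕ : ℕ → ℕ → ℕ
  adjSwapℕ zero zero = 1
  adjSwapℕ zero (suc zero) = 0
  adjSwapℕ zero (suc (suc c)) = suc (suc c)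
  adjSwapℕ (suc a) zero = zero
  adjSwapℕ (suc a) (suc c) = suc (adjSwapℕ a c)

  toℕ-adjSwap : ∀ {n} a (i : Fin n) → suc a < n → toℕ (adjSwap a i) ≡ adjSwapℕ a (toℕ i)
  toℕ-adjSwap {suc n} (suc a) Fin.zero _ = refl
  toℕ-adjSwap {suc n} (suc a) (Fin.suc i) (s<s p) = cong suc (toℕ-adjSwap a i p)
  toℕ-adjSwap {suc (suc n)} zero Fin.zero _ = refl
  toℕ-adjSwap {suc (suc n)} zero (Fin.suc Fin.zero) _ = refl
  toℕ-adjSwap {suc (suc n)} zero (Fin.suc (Fin.suc i)) _ = refl
  toℕ-adjSwap {suc zero} zero i (s<s ())

  adjSwapℕ-first : ∀ a → adjSwapℕ a a ≡ suc a
  adjSwapℕ-first zero = refl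
  adjSwapℕ-first (suc a) = cong suc (adjSwapℕ-first a)

  adjSwapℕ-second : ∀ a → adjSwapℕ a (suc a) ≡ a
  adjSwapℕ-second zero = refl
  adjSwapℕ-second (suc a) = cong suc (adjSwapℕ-second a)

  adjSwapℕ-other : ∀ a c → c ≢ a → c ≢ suc a → adjSwapℕ a c ≡ c
  adjSwapℕ-other zero zero c≢a _ = ⊥-elim (c≢a refl)
  adjSwapℕ-other zero (suc zero) _ c≢sa = ⊥-elim (c≢sa refl)
  adjSwapℕ-other zero (suc (suc c)) _ _ = refl
  adjSwapℕ-other (suc a) zero _ _ = refl
  adjSwapℕ-other (suc a) (suc c) c≢a c≢sa = cong suc (adjSwapℕ-other a c (c≢a ∘ cong suc) (c≢sa ∘ cong suc))

  adjSwapℕ-involutive : ∀ a c → adjSwapℕ a (adjSwapℕ a c) ≡ c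
  adjSwapℕ-involutive zero zero = refl
  adjSwapℕ-involutive zero (suc zero) = refl
  adjSwapℕ-involutive zero (suc (suc c)) = refl
  adjSwapℕ-involutive (suc a) zero = refl
  adjSwapℕ-involutive (suc a) (suc c) = cong suc (adjSwapℕ-involutive a c)

  data AdjSwapView (a c : ℕ) : Set where
    first : c ≡ a → AdjSwapView a c
    second : c ≡ suc a → AdjSwapView a c
    other : c ≢ a → c ≢ suc a → AdjSwapView a c

  adjSwapView : ∀ a c → AdjSwapView a c
  adjSwapView a c with c ℕ.≟ a | c ℕ.≟ suc a
  ... | yes c≡a | _ = first c≡a
  ... | no c≢a | yes c≡sa = second c≡sa
  ... | no c≢a | no c≢sa = other c≢a c≢sa

  adjSwapVec : ∀ {A : Set} {n} → ℕ → Vec A n → Vec A n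
  adjSwapVec (suc a) [] = []
  adjSwapVec (suc a) (x ∷ v) = x ∷ adjSwapVec a v
  adjSwapVec zero [] = []
  adjSwapVec zero (x ∷ []) = x ∷ []
  adjSwapVec zero (x ∷ y ∷ v) = y ∷ x ∷ v

  lookup-adjSwapVec : ∀ {A : Set} {n} a (v : Vec A n) (i : Fin n) → lookup (adjSwapVec a v) i ≡ lookup v (adjSwap a i)
  lookup-adjSwapVec (suc a) (x ∷ v) Fin.zero = refl
  lookup-adjSwapVec (suc a) (x ∷ v) (Fin.suc i) = lookup-adjSwapVec a v i
  lookup-adjSwapVec zero (x ∷ []) Fin.zero = refl
  lookup-adjSwapVec zero (x ∷ y ∷ v) Fin.zero = refl
  lookup-adjSwapVec zero (x ∷ y ∷ v) (Fin.suc Fin.zero) = refl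
  lookup-adjSwapVec zero (x ∷ y ∷ v) (Fin.suc (Fin.suc i)) = refl

module BigOp {C : Set} {_∙_ : C → C → C} {ε : C} (isCM : IsCommutativeMonoid _≡_ _∙_ ε) where

  open IsCommutativeMonoid isCM using (assoc; comm; identityˡ; identityʳ)
  open AdjacentTransposition
  open ≡-Reasoning

  private
    commutativeSemigroup : CommutativeSemigroup _ _
    commutativeSemigroup = record { isCommutativeSemigroup = IsCommutativeMonoid.isCommutativeSemigroup isCM }

  open import Algebra.Properties.CommutativeSemigroup commutativeSemigroup using (interchange)

  -- For ℚ._+_ and ℚ._*_ this is definitionally sumℚ and prodℚ.
  fold : {A : Set} → List A → (A → C) → C
  fold xs f = foldr (λ a s → f a ∙ s) ε xs

  fold-cong : {A : Set} (xs : List A) {f g : A → C} → (∀ x → f x ≡ g x) → fold xs f ≡ fold xs g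
  fold-cong [] e = refl
  fold-cong (x ∷ xs) e = cong₂ _∙_ (e x) (fold-cong xs e)

  fold-++ : {A : Set} (xs ys : List A) (f : A → C) → fold (xs ++ ys) f ≡ fold xs f ∙ fold ys f
  fold-++ [] ys f = sym (identityˡ _)
  fold-++ (x ∷ xs) ys f = trans (cong (f x ∙_) (fold-++ xs ys f)) (sym (assoc _ _ _))

  fold-map : {A B : Set} (xs : List A) (g : A → B) (f : B → C) → fold (map g xs) f ≡ fold xs (f ∘ g)
  fold-map [] g f = refl
  fold-map (x ∷ xs) g f = cong (f (g x) ∙_) (fold-map xs g f)

  fold-concatMap : {A B : Set} (xs : List A) (g : A → List B) (f : B → C) →
    fold (concatMap g xs) f ≡ fold xs (λ x → fold (g x) f)
  fold-concatMap [] g f = refl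
  fold-concatMap (x ∷ xs) g f =
    trans (fold-++ (g x) (concatMap g xs) f) (cong (fold (g x) f ∙_) (fold-concatMap xs g f))

  fold-∙ : {A : Set} (xs : List A) (f g : A → C) → fold xs (λ x → f x ∙ g x) ≡ fold xs f ∙ fold xs g
  fold-∙ [] f g = sym (identityˡ ε)
  fold-∙ (x ∷ xs) f g = trans (cong ((f x ∙ g x) ∙_) (fold-∙ xs f g)) (interchange _ _ _ _)

  fold-ε : {A : Set} (xs : List A) → fold xs (λ _ → ε) ≡ ε
  fold-ε [] = refl
  fold-ε (x ∷ xs) = trans (identityˡ _) (fold-ε xs)

  fold-comm : {A B : Set} (xs : List A) (ys : List B) (f : A → B → C) →
    fold xs (λ x → fold ys (f x)) ≡ fold ys (λ y → fold xs (λ x → f x y))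
  fold-comm [] ys f = sym (fold-ε ys)
  fold-comm (x ∷ xs) ys f =
    trans (cong (fold ys (f x) ∙_) (fold-comm xs ys f)) (sym (fold-∙ ys (f x) (λ y → fold xs (λ x → f x y))))

  fold-filterᵇ : {A : Set} (P : A → Bool) (xs : List A) (f : A → C) →
    fold (filterᵇ P xs) f ≡ fold xs (λ x → if P x then f x else ε)
  fold-filterᵇ P [] f = refl
  fold-filterᵇ P (x ∷ xs) f with P x
  ... | true = cong (f x ∙_) (fold-filterᵇ P xs f)
  ... | false = trans (fold-filterᵇ P xs f) (sym (identityˡ _))

  fold-if : {A : Set} (xs : List A) (b : Bool) (g : A → C) →
    fold xs (λ a → if b then g a else ε) ≡ (if b then fold xs g else ε)
  fold-if xs true g = refl
  fold-if xs false g = fold-ε xs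

  foldFin : ∀ {n} → (Fin n → C) → C
  foldFin {zero} f = ε
  foldFin {suc n} f = f Fin.zero ∙ foldFin (f ∘ Fin.suc)

  foldFin-cong : ∀ {n} {f g : Fin n → C} → (∀ i → f i ≡ g i) → foldFin f ≡ foldFin g
  foldFin-cong {zero} e = refl
  foldFin-cong {suc n} e = cong₂ _∙_ (e Fin.zero) (foldFin-cong (e ∘ Fin.suc))

  foldFin-∙ : ∀ n (f g : Fin n → C) → foldFin (λ i → f i ∙ g i) ≡ foldFin f ∙ foldFin g
  foldFin-∙ zero f g = sym (identityˡ ε)
  foldFin-∙ (suc n) f g = trans (cong ((f Fin.zero ∙ g Fin.zero) ∙_) (foldFin-∙ n (f ∘ Fin.suc) (g ∘ Fin.suc))) (interchange _ _ _ _)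

  foldFin-ε : ∀ n → foldFin {n} (λ _ → ε) ≡ ε
  foldFin-ε zero = refl
  foldFin-ε (suc n) = trans (identityˡ _) (foldFin-ε n)

  fold-allFin : (n : ℕ) (f : Fin n → C) → fold (allFin n) f ≡ foldFin f
  fold-allFin n f = fold-tabulate n id
    where
    fold-tabulate : (m : ℕ) (g : Fin m → Fin n) → fold (List.tabulate g) f ≡ foldFin (f ∘ g)
    fold-tabulate zero g = refl
    fold-tabulate (suc m) g = cong (f (g Fin.zero) ∙_) (fold-tabulate m (g ∘ Fin.suc))

  foldFin-indicator : (n b : ℕ) (b<n : b < n) (g : Fin n → C) →
    foldFin (λ i → if toℕ i ℕ.≡ᵇ b then g i else ε) ≡ g (fromℕ< b<n)
  foldFin-indicator (suc n) zero z<s g = trans (cong (g Fin.zero ∙_) (foldFin-ε n)) (identityʳ _)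
  foldFin-indicator (suc n) (suc b) (s<s b<n) g = trans (identityˡ _) (foldFin-indicator n b b<n (g ∘ Fin.suc))

  foldFin-adjSwap : (n a : ℕ) (f : Fin n → C) → foldFin (f ∘ adjSwap a) ≡ foldFin f
  foldFin-adjSwap zero a f = refl
  foldFin-adjSwap (suc zero) zero f = refl
  foldFin-adjSwap (suc (suc n)) zero f = begin
    f₁ ∙ (f₀ ∙ rest) ≡⟨ sym (assoc _ _ _) ⟩
    (f₁ ∙ f₀) ∙ rest ≡⟨ cong (_∙ rest) (comm _ _) ⟩
    (f₀ ∙ f₁) ∙ rest ≡⟨ assoc _ _ _ ⟩
    f₀ ∙ (f₁ ∙ rest) ∎
    where
    f₀ = f Fin.zero
    f₁ = f (Fin.suc Fin.zero)
    rest = foldFin (f ∘ Fin.suc ∘ Fin.suc)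
  foldFin-adjSwap (suc n) (suc a) f = cong (f Fin.zero ∙_) (foldFin-adjSwap n a (f ∘ Fin.suc))

  foldRange : ℕ → (ℕ → C) → C
  foldRange zero f = ε
  foldRange (suc n) f = f zero ∙ foldRange n (f ∘ suc)

  foldRange-cong : (n : ℕ) {f g : ℕ → C} → (∀ i → i < n → f i ≡ g i) → foldRange n f ≡ foldRange n g
  foldRange-cong zero e = refl
  foldRange-cong (suc n) e = cong₂ _∙_ (e zero z<s) (foldRange-cong n (λ i p → e (suc i) (s<s p)))

  foldRange-ε : (n : ℕ) → foldRange n (λ _ → ε) ≡ ε
  foldRange-ε zero = refl
  foldRange-ε (suc n) = trans (identityˡ _) (foldRange-ε n)

  fold-upTo : (n : ℕ) (f : ℕ → C) → fold (upTo n) f ≡ foldRange n f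
  fold-upTo n f = fold-applyUpTo n id
    where
    fold-applyUpTo : (m : ℕ) (g : ℕ → ℕ) → fold (applyUpTo g m) f ≡ foldRange m (f ∘ g)
    fold-applyUpTo zero g = refl
    fold-applyUpTo (suc m) g = cong (f (g zero) ∙_) (fold-applyUpTo m (g ∘ suc))

  fold-foldRange-comm : {A : Set} (xs : List A) (n : ℕ) (f : A → ℕ → C) →
    fold xs (λ a → foldRange n (f a)) ≡ foldRange n (λ k → fold xs (λ a → f a k))
  fold-foldRange-comm xs n f = trans (fold-cong xs (λ a → sym (fold-upTo n (f a))))
    (trans (fold-comm xs (upTo n) f) (fold-upTo n _))

  foldRange-indicator : (n b : ℕ) → b < n → (g : ℕ → C) →
    foldRange n (λ k → if k ℕ.≡ᵇ b then g k else ε) ≡ g b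
  foldRange-indicator (suc n) zero _ g = trans (cong (g 0 ∙_) (foldRange-ε n)) (identityʳ _)
  foldRange-indicator (suc n) (suc b) (s<s b<n) g = trans (identityˡ _) (foldRange-indicator n b b<n (g ∘ suc))

  foldFin-prefix : ∀ n r → r ≤ n → (c : C) →
    foldFin {n} (λ i → if does (toℕ i ℕ.<? r) then c else ε) ≡ foldRange r (λ _ → c)
  foldFin-prefix n zero _ c = foldFin-ε n
  foldFin-prefix (suc n) (suc r) (s≤s r≤n) c = cong (c ∙_) (foldFin-prefix n r r≤n c)

  fold-allFuns-suc : ∀ k n (H : Vec (Fin n) (suc k) → C) →
    fold (allFuns (suc k) n) H ≡ fold (allFuns k n) (λ v → fold (allFin n) (λ b → H (b ∷ v)))
  fold-allFuns-suc k n H = trans (fold-concatMap (allFuns k n) _ H)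
    (fold-cong (allFuns k n) (λ v → fold-map (allFin n) (λ a → a ∷ v) H))

  fold-allFuns-adjSwap : ∀ k n a (H : Vec (Fin n) k → C) →
    fold (allFuns k n) (H ∘ adjSwapVec a) ≡ fold (allFuns k n) H
  fold-allFuns-adjSwap zero n (suc a) H = refl
  fold-allFuns-adjSwap zero n zero H = refl
  fold-allFuns-adjSwap (suc k) n (suc a) H = begin
    fold (allFuns (suc k) n) (H ∘ adjSwapVec (suc a))
      ≡⟨ fold-allFuns-suc k n _ ⟩
    fold (allFuns k n) (λ v → fold (allFin n) (λ b → H (b ∷ adjSwapVec a v)))
      ≡⟨ fold-comm (allFuns k n) (allFin n) _ ⟩
    fold (allFin n) (λ b → fold (allFuns k n) (λ v → H (b ∷ adjSwapVec a v)))
      ≡⟨ fold-cong (allFin n) (λ b → fold-allFuns-adjSwap k n a (λ v → H (b ∷ v))) ⟩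
    fold (allFin n) (λ b → fold (allFuns k n) (λ v → H (b ∷ v)))
      ≡⟨ sym (fold-comm (allFuns k n) (allFin n) _) ⟩
    fold (allFuns k n) (λ v → fold (allFin n) (λ b → H (b ∷ v)))
      ≡⟨ sym (fold-allFuns-suc k n _) ⟩
    fold (allFuns (suc k) n) H ∎
  fold-allFuns-adjSwap (suc zero) n zero H = fold-cong (allFuns 1 n) (λ { (x ∷ []) → refl })
  fold-allFuns-adjSwap (suc (suc k)) n zero H = begin
    fold (allFuns (suc (suc k)) n) (H ∘ adjSwapVec zero)
      ≡⟨ fold-allFuns-suc (suc k) n _ ⟩
    fold (allFuns (suc k) n) (λ v → fold (allFin n) (λ b → H (adjSwapVec zero (b ∷ v))))
      ≡⟨ fold-allFuns-suc k n _ ⟩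
    fold (allFuns k n) (λ v → fold (allFin n) (λ c → fold (allFin n) (λ b → H (c ∷ b ∷ v))))
      ≡⟨ fold-cong (allFuns k n) (λ v → fold-comm (allFin n) (allFin n) _) ⟩
    fold (allFuns k n) (λ v → fold (allFin n) (λ b → fold (allFin n) (λ c → H (c ∷ b ∷ v))))
      ≡⟨ sym (fold-allFuns-suc k n _) ⟩
    fold (allFuns (suc k) n) (λ v → fold (allFin n) (λ c → H (c ∷ v)))
      ≡⟨ sym (fold-allFuns-suc (suc k) n _) ⟩
    fold (allFuns (suc (suc k)) n) H ∎

module Σℚ = BigOp ℚP.+-0-isCommutativeMonoid
module Πℚ = BigOp ℚP.*-1-isCommutativeMonoid
module Σℕ = BigOp ℕP.+-0-isCommutativeMonoid
module Maxℕ = BigOp ℕP.⊔-0-isCommutativeMonoid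

module RationalFacts where

  open import Data.Rational using (_+_; _*_; _-_; -_; 1/_; ½; ≢-nonZero)
  open ≡-Reasoning

  ÷'-by-inverse : ∀ p q w → q * w ≡ 1ℚ → p ÷' q ≡ p * w
  ÷'-by-inverse p q w e with q ℚP.≟ 0ℚ
  ... | yes refl with trans (sym e) (ℚP.*-zeroˡ w)
  ... | ()
  ÷'-by-inverse p q w e | no q≢0 = cong (p *_) (begin
      1/ q             ≡⟨ sym (ℚP.*-identityʳ _) ⟩
      1/ q * 1ℚ        ≡⟨ cong (1/ q *_) (sym e) ⟩
      1/ q * (q * w)   ≡⟨ sym (ℚP.*-assoc (1/ q) q w) ⟩
      (1/ q * q) * w   ≡⟨ cong (_* w) (ℚP.*-inverseˡ q) ⟩
      1ℚ * w           ≡⟨ ℚP.*-identityˡ w ⟩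
      w                ∎)
    where instance _ = ≢-nonZero q≢0

  ÷'-≡-*-÷' : ∀ p q → p ÷' q ≡ p * (1ℚ ÷' q)
  ÷'-≡-*-÷' p q with q ℚP.≟ 0ℚ
  ... | yes _ = sym (ℚP.*-zeroʳ p)
  ... | no _ = cong (p *_) (sym (ℚP.*-identityˡ _))

  x≢y⇒x-y≢0 : ∀ u v → u ≢ v → u - v ≢ 0ℚ
  x≢y⇒x-y≢0 u v u≢v u-v≡0 = u≢v (begin
    u            ≡⟨ solve 2 (λ u v → u := (u :- v) :+ v) refl u v ⟩
    (u - v) + v  ≡⟨ cong (_+ v) u-v≡0 ⟩
    0ℚ + v       ≡⟨ ℚP.+-identityˡ v ⟩
    v            ∎)

  ≡-neg⇒≡0 : ∀ s → s ≡ - s → s ≡ 0ℚ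
  ≡-neg⇒≡0 s e = begin
    s              ≡⟨ solve 1 (λ s → s := (s :+ s) :* con ½) refl s ⟩
    (s + s) * ½    ≡⟨ cong (λ z → (s + z) * ½) e ⟩
    (s + - s) * ½  ≡⟨ cong (_* ½) (ℚP.+-inverseʳ s) ⟩
    0ℚ * ½         ≡⟨ ℚP.*-zeroˡ ½ ⟩
    0ℚ             ∎

  sum-neg : ∀ {A : Set} (xs : List A) (h : A → ℚ) → Σℚ.fold xs (λ w → - h w) ≡ - Σℚ.fold xs h
  sum-neg [] h = refl
  sum-neg (x ∷ xs) h = trans (cong (- h x +_) (sum-neg xs h)) (sym (ℚP.neg-distrib-+ (h x) (Σℚ.fold xs h)))

  sum-*ˡ : ∀ {A : Set} (xs : List A) (c : ℚ) (f : A → ℚ) → Σℚ.fold xs (λ w → c * f w) ≡ c * Σℚ.fold xs f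
  sum-*ˡ [] c f = sym (ℚP.*-zeroʳ c)
  sum-*ˡ (x ∷ xs) c f = trans (cong (c * f x +_) (sum-*ˡ xs c f)) (sym (ℚP.*-distribˡ-+ c (f x) _))

  sumRange-*ˡ : ∀ (N : ℕ) (c : ℚ) (f : ℕ → ℚ) → Σℚ.foldRange N (λ k → c * f k) ≡ c * Σℚ.foldRange N f
  sumRange-*ˡ zero c f = sym (ℚP.*-zeroʳ c)
  sumRange-*ˡ (suc N) c f = trans (cong (c * f 0 +_) (sumRange-*ˡ N c (f ∘ suc))) (sym (ℚP.*-distribˡ-+ c (f 0) _))

  prodRange-const : ∀ r (c : ℚ) → Πℚ.foldRange r (λ _ → c) ≡ pow c r
  prodRange-const zero c = refl
  prodRange-const (suc r) c = cong (c *_) (prodRange-const r c)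

  kernelFactor : ℚ → ℚ → ℚ → ℚ
  kernelFactor β u v = oplus β u v ÷' ominus β u v

  -- (v ⊕ u)/(v ⊖ u) = (u ⊕ v)(1 + βu)/(v - u), while (u ⊕ v)/(u ⊖ v) = (u ⊕ v)(1 + βv)/(u - v).
  kernelFactor-swap : ∀ β u v → u ≢ v → 1ℚ + β * u ≢ 0ℚ → 1ℚ + β * v ≢ 0ℚ →
    kernelFactor β v u * (1ℚ + β * v) ≡ - ((1ℚ + β * u) * kernelFactor β u v)
  kernelFactor-swap β u v u≢v Eu≢0 Ev≢0 = begin
    kernelFactor β v u * Ev
      ≡⟨ cong (_* Ev) (÷'-by-inverse (oplus β v u) (ominus β v u) (Eu * (- 1/δ)) vu-inverse) ⟩
    oplus β v u * (Eu * (- 1/δ)) * Ev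
      ≡⟨ solve 6 (λ β u v Eu Ev i → (v :+ u :+ β :* v :* u) :* (Eu :* (:- i)) :* Ev
                                   := :- (Eu :* ((u :+ v :+ β :* u :* v) :* (Ev :* i)))) refl β u v Eu Ev 1/δ ⟩
    - (Eu * (oplus β u v * (Ev * 1/δ)))
      ≡⟨ cong (λ z → - (Eu * z)) (sym (÷'-by-inverse (oplus β u v) (ominus β u v) (Ev * 1/δ) uv-inverse)) ⟩
    - (Eu * kernelFactor β u v) ∎
    where
    Eu = 1ℚ + β * u
    Ev = 1ℚ + β * v
    δ = u - v
    instance
      _ = ≢-nonZero (x≢y⇒x-y≢0 u v u≢v)
      _ = ≢-nonZero Eu≢0
      _ = ≢-nonZero Ev≢0
    1/δ = 1/ δ
    uv-inverse : ominus β u v * (Ev * 1/δ) ≡ 1ℚ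
    uv-inverse = begin
      ominus β u v * (Ev * 1/δ)   ≡⟨ cong (_* (Ev * 1/δ)) (÷'-by-inverse δ Ev (1/ Ev) (ℚP.*-inverseʳ Ev)) ⟩
      δ * 1/ Ev * (Ev * 1/δ)      ≡⟨ solve 4 (λ δ i E j → δ :* i :* (E :* j) := (δ :* j) :* (E :* i)) refl δ (1/ Ev) Ev 1/δ ⟩
      (δ * 1/δ) * (Ev * 1/ Ev)    ≡⟨ cong₂ _*_ (ℚP.*-inverseʳ δ) (ℚP.*-inverseʳ Ev) ⟩
      1ℚ                          ∎
    vu-inverse : ominus β v u * (Eu * (- 1/δ)) ≡ 1ℚ
    vu-inverse = begin
      ominus β v u * (Eu * (- 1/δ))  ≡⟨ cong (_* (Eu * (- 1/δ))) (÷'-by-inverse (v - u) Eu (1/ Eu) (ℚP.*-inverseʳ Eu)) ⟩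
      (v - u) * 1/ Eu * (Eu * (- 1/δ))
        ≡⟨ solve 5 (λ u v i E j → (v :- u) :* i :* (E :* (:- j)) := ((u :- v) :* j) :* (E :* i)) refl u v (1/ Eu) Eu 1/δ ⟩
      (δ * 1/δ) * (Eu * 1/ Eu)       ≡⟨ cong₂ _*_ (ℚP.*-inverseʳ δ) (ℚP.*-inverseʳ Eu) ⟩
      1ℚ                             ∎

module KernelSplitting (n r : ℕ) (β : ℚ) (a : ℕ) (a+1<r : suc a < r) (r≤n : r ≤ n) where

  open import Data.Rational using (_*_)
  open BoolReflection
  open AdjacentTransposition
  open RationalFacts using (kernelFactor)
  open ≡-Reasoning

  a<r : a < r
  a<r = ℕP.<-trans (ℕP.n<1+n a) a+1<r

  a<n : a < n
  a<n = ℕP.<-≤-trans a<r r≤n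

  a+1<n : suc a < n
  a+1<n = ℕP.<-≤-trans a+1<r r≤n

  pos₀ pos₁ : Fin n
  pos₀ = fromℕ< a<n
  pos₁ = fromℕ< a+1<n

  pos₀≢pos₁ : pos₀ ≢ pos₁
  pos₀≢pos₁ e = ℕP.1+n≢n (sym (begin
    a          ≡⟨ sym (FinP.toℕ-fromℕ< _) ⟩
    toℕ pos₀   ≡⟨ cong toℕ e ⟩
    toℕ pos₁   ≡⟨ FinP.toℕ-fromℕ< _ ⟩
    suc a      ∎))

  adjSwap-pos₀ : adjSwap a pos₀ ≡ pos₁
  adjSwap-pos₀ = FinP.toℕ-injective (begin
    toℕ (adjSwap a pos₀)   ≡⟨ toℕ-adjSwap a pos₀ a+1<n ⟩
    adjSwapℕ a (toℕ pos₀)  ≡⟨ cong (adjSwapℕ a) (FinP.toℕ-fromℕ< _) ⟩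
    adjSwapℕ a a           ≡⟨ adjSwapℕ-first a ⟩
    suc a                  ≡⟨ sym (FinP.toℕ-fromℕ< _) ⟩
    toℕ pos₁               ∎)

  adjSwap-pos₁ : adjSwap a pos₁ ≡ pos₀
  adjSwap-pos₁ = trans (cong (adjSwap a) (sym adjSwap-pos₀)) (adjSwap-involutive a pos₀)

  pairFactor : ℕ → ℕ → ℚ → ℚ → ℚ
  pairFactor c d u v = if does (c ℕ.<? r) ∧ does (c ℕ.<? d) then kernelFactor β u v else 1ℚ

  isChosenPairᵇ : ℕ → ℕ → Bool
  isChosenPairᵇ c d = (c ℕ.≡ᵇ a) ∧ (d ℕ.≡ᵇ suc a)

  isOtherPairᵇ : ℕ → ℕ → Bool
  isOtherPairᵇ c d = not (isChosenPairᵇ c d) ∧ (does (c ℕ.<? r) ∧ does (c ℕ.<? d))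

  chosenPairFactor otherPairFactor : ℕ → ℕ → ℚ → ℚ → ℚ
  chosenPairFactor c d u v = if isChosenPairᵇ c d then kernelFactor β u v else 1ℚ
  otherPairFactor c d u v = if isOtherPairᵇ c d then kernelFactor β u v else 1ℚ

  pairFactor-split : ∀ c d u v → pairFactor c d u v ≡ chosenPairFactor c d u v * otherPairFactor c d u v
  pairFactor-split c d u v = split (c ℕ.≡ᵇ a) (d ℕ.≡ᵇ suc a) refl refl
    where
    split : ∀ b₁ b₂ → (c ℕ.≡ᵇ a) ≡ b₁ → (d ℕ.≡ᵇ suc a) ≡ b₂ →
      pairFactor c d u v ≡ (if b₁ ∧ b₂ then kernelFactor β u v else 1ℚ)
                         * (if not (b₁ ∧ b₂) ∧ (does (c ℕ.<? r) ∧ does (c ℕ.<? d)) then kernelFactor β u v else 1ℚ)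
    split true true e₁ e₂ with ≡ᵇ-true⇒≡ c a e₁ | ≡ᵇ-true⇒≡ d (suc a) e₂
    ... | refl | refl =
      trans (if-true (does (a ℕ.<? r) ∧ does (a ℕ.<? suc a)) (∧-intro (<?-true a<r) (<?-true (ℕP.n<1+n a))))
            (sym (ℚP.*-identityʳ _))
    split true false _ _ = sym (ℚP.*-identityˡ _)
    split false _ _ _ = sym (ℚP.*-identityˡ _)

  OtherPair : ℕ → ℕ → Set
  OtherPair c d = ¬ (c ≡ a × d ≡ suc a) × c < r × c < d

  isOtherPairᵇ⇒ : ∀ c d → isOtherPairᵇ c d ≡ true → OtherPair c d
  isOtherPairᵇ⇒ c d e = not-chosen , <?-true⁻ (∧-elimˡ range) , <?-true⁻ (∧-elimʳ {does (c ℕ.<? r)} range)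
    where
    range = ∧-elimʳ {not (isChosenPairᵇ c d)} e
    not-chosen : ¬ (c ≡ a × d ≡ suc a)
    not-chosen (refl , refl) with trans (sym (cong not (∧-intro {a ℕ.≡ᵇ a} (≡ᵇ-refl a) (≡ᵇ-refl (suc a)))))
                                        (∧-elimˡ {not (isChosenPairᵇ c d)} e)
    ... | ()

  ⇒isOtherPairᵇ : ∀ c d → OtherPair c d → isOtherPairᵇ c d ≡ true
  ⇒isOtherPairᵇ c d (not-chosen , c<r , c<d) = ∧-intro (not-intro not-chosenᵇ) (∧-intro (<?-true c<r) (<?-true c<d))
    where
    not-chosenᵇ : isChosenPairᵇ c d ≡ false
    not-chosenᵇ with c ℕ.≡ᵇ a in e₁ | d ℕ.≡ᵇ suc a in e₂
    ... | true | true = ⊥-elim (not-chosen (≡ᵇ-true⇒≡ c a e₁ , ≡ᵇ-true⇒≡ d (suc a) e₂))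
    ... | true | false = refl
    ... | false | _ = refl

  OtherPair-adjSwap : ∀ c d → OtherPair c d → OtherPair (adjSwapℕ a c) (adjSwapℕ a d)
  OtherPair-adjSwap c d (not-chosen , c<r , c<d) with adjSwapView a c | adjSwapView a d
  ... | first refl | first refl = ⊥-elim (ℕP.<-irrefl refl c<d)
  ... | first refl | second refl = ⊥-elim (not-chosen (refl , refl))
  ... | first refl | other d≢a d≢a+1 rewrite adjSwapℕ-first a | adjSwapℕ-other a d d≢a d≢a+1 =
        (λ { (e , _) → ℕP.1+n≢n e }) , a+1<r , ℕP.≤∧≢⇒< c<d (d≢a+1 ∘ sym)
  ... | second refl | first refl = ⊥-elim (ℕP.<-asym c<d (ℕP.n<1+n a))
  ... | second refl | second refl = ⊥-elim (ℕP.<-irrefl refl c<d)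
  ... | second refl | other d≢a d≢a+1 rewrite adjSwapℕ-second a | adjSwapℕ-other a d d≢a d≢a+1 =
        (λ { (_ , e) → d≢a+1 e }) , a<r , ℕP.<-trans (ℕP.n<1+n a) c<d
  ... | other c≢a c≢a+1 | first refl rewrite adjSwapℕ-other a c c≢a c≢a+1 | adjSwapℕ-first a =
        (λ { (e , _) → c≢a e }) , c<r , ℕP.<-trans c<d (ℕP.n<1+n a)
  ... | other c≢a c≢a+1 | second refl rewrite adjSwapℕ-other a c c≢a c≢a+1 | adjSwapℕ-second a =
        (λ { (e , _) → c≢a e }) , c<r , ℕP.≤∧≢⇒< (ℕP.≤-pred c<d) c≢a
  ... | other c≢a c≢a+1 | other d≢a d≢a+1 rewrite adjSwapℕ-other a c c≢a c≢a+1 | adjSwapℕ-other a d d≢a d≢a+1 =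
        not-chosen , c<r , c<d

  isOtherPairᵇ-adjSwap : ∀ c d → isOtherPairᵇ (adjSwapℕ a c) (adjSwapℕ a d) ≡ isOtherPairᵇ c d
  isOtherPairᵇ-adjSwap c d = bool-ext
    (λ e → ⇒isOtherPairᵇ c d (subst₂ OtherPair (adjSwapℕ-involutive a c) (adjSwapℕ-involutive a d)
             (OtherPair-adjSwap (adjSwapℕ a c) (adjSwapℕ a d) (isOtherPairᵇ⇒ (adjSwapℕ a c) (adjSwapℕ a d) e))))
    (λ e → ⇒isOtherPairᵇ (adjSwapℕ a c) (adjSwapℕ a d) (OtherPair-adjSwap c d (isOtherPairᵇ⇒ c d e)))

  otherKernel : (Fin n → ℚ) → ℚ
  otherKernel y = Πℚ.foldFin (λ i → Πℚ.foldFin (λ j → otherPairFactor (toℕ i) (toℕ j) (y i) (y j)))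

  kernel-split : ∀ y → kernel β r y ≡ kernelFactor β (y pos₀) (y pos₁) * otherKernel y
  kernel-split y = begin
    kernel β r y
      ≡⟨ trans (Πℚ.fold-allFin n (λ i → Πℚ.fold (allFin n) (P i))) (Πℚ.foldFin-cong (λ i → Πℚ.fold-allFin n (P i))) ⟩
    Πℚ.foldFin (λ i → Πℚ.foldFin (P i))
      ≡⟨ Πℚ.foldFin-cong (λ i → Πℚ.foldFin-cong (λ j → pairFactor-split (toℕ i) (toℕ j) (y i) (y j))) ⟩
    Πℚ.foldFin (λ i → Πℚ.foldFin (λ j → chosen i j * otherPairFactor (toℕ i) (toℕ j) (y i) (y j)))
      ≡⟨ trans (Πℚ.foldFin-cong (λ i → Πℚ.foldFin-∙ n (chosen i) _)) (Πℚ.foldFin-∙ n _ _) ⟩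
    Πℚ.foldFin (λ i → Πℚ.foldFin (chosen i)) * otherKernel y
      ≡⟨ cong (_* otherKernel y) only-chosen ⟩
    kernelFactor β (y pos₀) (y pos₁) * otherKernel y ∎
    where
    P : Fin n → Fin n → ℚ
    P i j = pairFactor (toℕ i) (toℕ j) (y i) (y j)
    chosen : Fin n → Fin n → ℚ
    chosen i j = chosenPairFactor (toℕ i) (toℕ j) (y i) (y j)
    only-chosen : Πℚ.foldFin (λ i → Πℚ.foldFin (chosen i)) ≡ kernelFactor β (y pos₀) (y pos₁)
    only-chosen =
      trans (Πℚ.foldFin-cong (λ i → trans
              (Πℚ.foldFin-cong (λ j → if-∧ (toℕ i ℕ.≡ᵇ a) (toℕ j ℕ.≡ᵇ suc a) {kernelFactor β (y i) (y j)} {1ℚ}))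
              (Πℚ.foldFin-indicator n (suc a) a+1<n (λ j → if toℕ i ℕ.≡ᵇ a then kernelFactor β (y i) (y j) else 1ℚ))))
            (Πℚ.foldFin-indicator n a a<n (λ i → kernelFactor β (y i) (y pos₁)))

  otherKernel-adjSwap : ∀ y → otherKernel (y ∘ adjSwap a) ≡ otherKernel y
  otherKernel-adjSwap y = begin
    Πℚ.foldFin (λ i → Πℚ.foldFin (λ j → otherPairFactor (toℕ i) (toℕ j) (y (adjSwap a i)) (y (adjSwap a j))))
      ≡⟨ Πℚ.foldFin-cong (λ i → Πℚ.foldFin-cong (λ j → relabel i j)) ⟩
    Πℚ.foldFin (λ i → Πℚ.foldFin (λ j → F (adjSwap a i) (adjSwap a j)))
      ≡⟨ Πℚ.foldFin-cong (λ i → Πℚ.foldFin-adjSwap n a (F (adjSwap a i))) ⟩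
    Πℚ.foldFin (λ i → Πℚ.foldFin (F (adjSwap a i)))
      ≡⟨ Πℚ.foldFin-adjSwap n a (λ i → Πℚ.foldFin (F i)) ⟩
    otherKernel y ∎
    where
    F : Fin n → Fin n → ℚ
    F i j = otherPairFactor (toℕ i) (toℕ j) (y i) (y j)
    relabel : ∀ i j → otherPairFactor (toℕ i) (toℕ j) (y (adjSwap a i)) (y (adjSwap a j)) ≡ F (adjSwap a i) (adjSwap a j)
    relabel i j = begin
      otherPairFactor (toℕ i) (toℕ j) u v
        ≡⟨ cong (λ b → if b then kernelFactor β u v else 1ℚ) (sym (isOtherPairᵇ-adjSwap (toℕ i) (toℕ j))) ⟩
      otherPairFactor (adjSwapℕ a (toℕ i)) (adjSwapℕ a (toℕ j)) u v
        ≡⟨ cong₂ (λ c d → otherPairFactor c d u v) (sym (toℕ-adjSwap a i a+1<n)) (sym (toℕ-adjSwap a j a+1<n)) ⟩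
      F (adjSwap a i) (adjSwap a j) ∎
      where
      u = y (adjSwap a i)
      v = y (adjSwap a j)

module PermutationFilter {n : ℕ} where

  open BoolReflection
  open AdjacentTransposition

  IsInjective : Vec (Fin n) n → Set
  IsInjective w = ∀ i j → i ≡ j ⊎ lookup w i ≢ lookup w j

  FixesFrom : ℕ → Vec (Fin n) n → Set
  FixesFrom r w = ∀ i → toℕ i < r ⊎ lookup w i ≡ i

  injectiveᵇ⇒ : ∀ w → injectiveᵇ w ≡ true → IsInjective w
  injectiveᵇ⇒ w e i j = does-∨-not⁻ (i Fin.≟ j) (lookup w i Fin.≟ lookup w j) (and-allFin⁻ n _ (and-allFin⁻ n _ e i) j)

  ⇒injectiveᵇ : ∀ w → IsInjective w → injectiveᵇ w ≡ true
  ⇒injectiveᵇ w h = and-allFin⁺ n _ (λ i → and-allFin⁺ n _ (λ j →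
    does-∨-not⁺ (i Fin.≟ j) (lookup w i Fin.≟ lookup w j) (h i j)))

  fixesFromᵇ⇒ : ∀ r w → fixesFromᵇ r w ≡ true → FixesFrom r w
  fixesFromᵇ⇒ r w e i = does-∨⁻ (toℕ i ℕ.<? r) (lookup w i Fin.≟ i) (and-allFin⁻ n _ e i)

  ⇒fixesFromᵇ : ∀ r w → FixesFrom r w → fixesFromᵇ r w ≡ true
  ⇒fixesFromᵇ r w h = and-allFin⁺ n _ (λ i → does-∨⁺ (toℕ i ℕ.<? r) (lookup w i Fin.≟ i) (h i))

  isPermᵇ : ℕ → Vec (Fin n) n → Bool
  isPermᵇ r w = injectiveᵇ w ∧ fixesFromᵇ r w

  module _ (a : ℕ) where

    IsInjective-adjSwap⁺ : ∀ w → IsInjective w → IsInjective (adjSwapVec a w)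
    IsInjective-adjSwap⁺ w h i j with h (adjSwap a i) (adjSwap a j)
    ... | inj₁ e = inj₁ (adjSwap-injective a e)
    ... | inj₂ ne = inj₂ (λ e → ne (trans (sym (lookup-adjSwapVec a w i)) (trans e (lookup-adjSwapVec a w j))))

    IsInjective-adjSwap⁻ : ∀ w → IsInjective (adjSwapVec a w) → IsInjective w
    IsInjective-adjSwap⁻ w h i j with h (adjSwap a i) (adjSwap a j)
    ... | inj₁ e = inj₁ (adjSwap-injective a e)
    ... | inj₂ ne = inj₂ (λ e → ne (trans (unswap i) (trans e (sym (unswap j)))))
      where
      unswap : ∀ k → lookup (adjSwapVec a w) (adjSwap a k) ≡ lookup w k
      unswap k = trans (lookup-adjSwapVec a w (adjSwap a k)) (cong (lookup w) (adjSwap-involutive a k))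

    module _ (r : ℕ) (a+1<r : suc a < r) (r≤n : r ≤ n) where

      adjSwap-fixes : ∀ i → ¬ toℕ i < r → adjSwap a i ≡ i
      adjSwap-fixes i i≮r = FinP.toℕ-injective (trans (toℕ-adjSwap a i (ℕP.<-≤-trans a+1<r r≤n))
        (adjSwapℕ-other a (toℕ i) (λ e → i≮r (subst (_< r) (sym e) (ℕP.<-trans (ℕP.n<1+n a) a+1<r)))
                                  (λ e → i≮r (subst (_< r) (sym e) a+1<r))))

      FixesFrom-adjSwap⁺ : ∀ w → FixesFrom r w → FixesFrom r (adjSwapVec a w)
      FixesFrom-adjSwap⁺ w h i with toℕ i ℕ.<? r | h i
      ... | yes i<r | _ = inj₁ i<r
      ... | no i≮r | inj₁ i<r = ⊥-elim (i≮r i<r)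
      ... | no i≮r | inj₂ e = inj₂ (trans (lookup-adjSwapVec a w i) (trans (cong (lookup w) (adjSwap-fixes i i≮r)) e))

      FixesFrom-adjSwap⁻ : ∀ w → FixesFrom r (adjSwapVec a w) → FixesFrom r w
      FixesFrom-adjSwap⁻ w h i with toℕ i ℕ.<? r | h i
      ... | yes i<r | _ = inj₁ i<r
      ... | no i≮r | inj₁ i<r = ⊥-elim (i≮r i<r)
      ... | no i≮r | inj₂ e =
        inj₂ (trans (cong (lookup w) (sym (adjSwap-fixes i i≮r))) (trans (sym (lookup-adjSwapVec a w i)) e))

      isPermᵇ-adjSwap : ∀ w → isPermᵇ r (adjSwapVec a w) ≡ isPermᵇ r w
      isPermᵇ-adjSwap w = cong₂ _∧_
        (bool-ext (λ e → ⇒injectiveᵇ w (IsInjective-adjSwap⁻ w (injectiveᵇ⇒ (adjSwapVec a w) e)))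
                  (λ e → ⇒injectiveᵇ (adjSwapVec a w) (IsInjective-adjSwap⁺ w (injectiveᵇ⇒ w e))))
        (bool-ext (λ e → ⇒fixesFromᵇ r w (FixesFrom-adjSwap⁻ w (fixesFromᵇ⇒ r (adjSwapVec a w) e)))
                  (λ e → ⇒fixesFromᵇ r (adjSwapVec a w) (FixesFrom-adjSwap⁺ w (fixesFromᵇ⇒ r w e))))

module Symmetrizer (n r : ℕ) (β : ℚ) (x : Fin n → ℚ) where

  open import Data.Rational using (_+_; _*_; -_)
  open BoolReflection
  open AdjacentTransposition
  open RationalFacts
  open PermutationFilter
  open ≡-Reasoning

  -- r! times the symmetrisation of f · kernel; the factor 1/r! is carried separately.
  S : ((Fin n → ℚ) → ℚ) → ℚ
  S f = sumℚ (Sym n r) (λ w → act w (λ y → f y * kernel β r y) x)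

  S-cong : ∀ f f' → (∀ y → f y ≡ f' y) → S f ≡ S f'
  S-cong f f' e = Σℚ.fold-cong (Sym n r) (λ w → cong (_* kernel β r (λ i → x (lookup w i))) (e _))

  S-*ˡ : ∀ c f → S (λ y → c * f y) ≡ c * S f
  S-*ˡ c f = trans (Σℚ.fold-cong (Sym n r) (λ w → ℚP.*-assoc c _ _)) (sum-*ˡ (Sym n r) c _)

  S-linear : ∀ f f' c → S (λ y → f y + c * f' y) ≡ S f + c * S f'
  S-linear f f' c = begin
    S (λ y → f y + c * f' y)
      ≡⟨ Σℚ.fold-cong (Sym n r) (λ w → solve 4 (λ F F' c K → (F :+ c :* F') :* K := F :* K :+ c :* (F' :* K))
                                                refl (f (y w)) (f' (y w)) c (kernel β r (y w))) ⟩
    Σℚ.fold (Sym n r) (λ w → fK w + c * f'K w)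
      ≡⟨ Σℚ.fold-∙ (Sym n r) fK (λ w → c * f'K w) ⟩
    S f + Σℚ.fold (Sym n r) (λ w → c * f'K w)
      ≡⟨ cong (S f +_) (sum-*ˡ (Sym n r) c f'K) ⟩
    S f + c * S f' ∎
    where
    y : Vec (Fin n) n → Fin n → ℚ
    y w i = x (lookup w i)
    fK f'K : Vec (Fin n) n → ℚ
    fK w = f (y w) * kernel β r (y w)
    f'K w = f' (y w) * kernel β r (y w)

  kernel-cong : ∀ (y y' : Fin n → ℚ) → (∀ i → y i ≡ y' i) → kernel β r y ≡ kernel β r y'
  kernel-cong y y' e = Πℚ.fold-cong (allFin n) (λ i → Πℚ.fold-cong (allFin n) (λ j →
    cong₂ (λ u v → if does (toℕ i ℕ.<? r) ∧ does (toℕ i ℕ.<? toℕ j) then kernelFactor β u v else 1ℚ) (e i) (e j)))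

  -- The transposition of positions a, a + 1 maps Sym n r to itself, fixes g and the rest of the
  -- kernel, and changes the sign of the chosen kernel factor times (1 + β y_a) (kernelFactor-swap).
  module Vanishing (x-injective : ∀ i j → i ≢ j → x i ≢ x j) (1+βx≢0 : ∀ j → 1ℚ + β * x j ≢ 0ℚ)
                   (a : ℕ) (a+1<r : suc a < r) (r≤n : r ≤ n)
                   (g : (Fin n → ℚ) → ℚ) (g-cong : ∀ y y' → (∀ i → y i ≡ y' i) → g y ≡ g y')
                   (g-adjSwap : ∀ y → g (y ∘ adjSwap a) ≡ g y) where

    open KernelSplitting n r β a a+1<r r≤n

    Φ : (Fin n → ℚ) → ℚ
    Φ y = (g y * (1ℚ + β * y pos₀)) * kernel β r y

    Φ-cong : ∀ y y' → (∀ i → y i ≡ y' i) → Φ y ≡ Φ y'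
    Φ-cong y y' e = cong₂ _*_ (cong₂ _*_ (g-cong y y' e) (cong (λ z → 1ℚ + β * z) (e pos₀))) (kernel-cong y y' e)

    Φ-adjSwap : ∀ (y : Fin n → ℚ) → y pos₀ ≢ y pos₁ → 1ℚ + β * y pos₀ ≢ 0ℚ → 1ℚ + β * y pos₁ ≢ 0ℚ →
      Φ (y ∘ adjSwap a) ≡ - Φ y
    Φ-adjSwap y ne E₀≢0 E₁≢0 = begin
      (g (y ∘ adjSwap a) * (1ℚ + β * y (adjSwap a pos₀))) * kernel β r (y ∘ adjSwap a)
        ≡⟨ cong₂ (λ z w → (z * (1ℚ + β * y w)) * kernel β r (y ∘ adjSwap a)) (g-adjSwap y) adjSwap-pos₀ ⟩
      (G * E₁) * kernel β r (y ∘ adjSwap a)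
        ≡⟨ cong ((G * E₁) *_) (kernel-split (y ∘ adjSwap a)) ⟩
      (G * E₁) * (kernelFactor β (y (adjSwap a pos₀)) (y (adjSwap a pos₁)) * otherKernel (y ∘ adjSwap a))
        ≡⟨ cong₂ (λ u v → (G * E₁) * (kernelFactor β (y u) (y v) * otherKernel (y ∘ adjSwap a))) adjSwap-pos₀ adjSwap-pos₁ ⟩
      (G * E₁) * (kernelFactor β (y pos₁) (y pos₀) * otherKernel (y ∘ adjSwap a))
        ≡⟨ cong (λ z → (G * E₁) * (kernelFactor β (y pos₁) (y pos₀) * z)) (otherKernel-adjSwap y) ⟩
      (G * E₁) * (kernelFactor β (y pos₁) (y pos₀) * K)
        ≡⟨ solve 4 (λ G E F K → (G :* E) :* (F :* K) := G :* (F :* E) :* K) refl G E₁ (kernelFactor β (y pos₁) (y pos₀)) K ⟩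
      G * (kernelFactor β (y pos₁) (y pos₀) * E₁) * K
        ≡⟨ cong (λ z → G * z * K) (kernelFactor-swap β (y pos₀) (y pos₁) ne E₀≢0 E₁≢0) ⟩
      G * (- (E₀ * kernelFactor β (y pos₀) (y pos₁))) * K
        ≡⟨ solve 4 (λ G E F K → G :* (:- (E :* F)) :* K := :- ((G :* E) :* (F :* K))) refl G E₀ (kernelFactor β (y pos₀) (y pos₁)) K ⟩
      - ((G * E₀) * (kernelFactor β (y pos₀) (y pos₁) * K))
        ≡⟨ cong (λ z → - ((G * E₀) * z)) (sym (kernel-split y)) ⟩
      - Φ y ∎
      where
      G = g y
      E₀ = 1ℚ + β * y pos₀
      E₁ = 1ℚ + β * y pos₁
      K = otherKernel y

    act-adjSwap : ∀ w → IsInjective w → act (adjSwapVec a w) Φ x ≡ - act w Φ x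
    act-adjSwap w inj = trans (Φ-cong _ (y ∘ adjSwap a) (λ i → cong x (lookup-adjSwapVec a w i)))
                              (Φ-adjSwap y y₀≢y₁ (1+βx≢0 _) (1+βx≢0 _))
      where
      y : Fin n → ℚ
      y i = x (lookup w i)
      y₀≢y₁ : y pos₀ ≢ y pos₁
      y₀≢y₁ with inj pos₀ pos₁
      ... | inj₁ e = ⊥-elim (pos₀≢pos₁ e)
      ... | inj₂ ne = x-injective _ _ ne

    H : Vec (Fin n) n → ℚ
    H w = if isPermᵇ r w then act w Φ x else 0ℚ

    H-adjSwap : ∀ w → H (adjSwapVec a w) ≡ - H w
    H-adjSwap w = trans (cong (λ b → if b then act (adjSwapVec a w) Φ x else 0ℚ) (isPermᵇ-adjSwap a r a+1<r r≤n w))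
                        (by-cases (isPermᵇ r w) refl)
      where
      by-cases : ∀ b → isPermᵇ r w ≡ b → (if b then act (adjSwapVec a w) Φ x else 0ℚ) ≡ - (if b then act w Φ x else 0ℚ)
      by-cases true e = act-adjSwap w (injectiveᵇ⇒ w (∧-elimˡ e))
      by-cases false _ = refl

    S-vanishes : S (λ y → g y * (1ℚ + β * y pos₀)) ≡ 0ℚ
    S-vanishes = ≡-neg⇒≡0 _ (begin
      Σℚ.fold (Sym n r) (λ w → act w Φ x)      ≡⟨ Σℚ.fold-filterᵇ (isPermᵇ r) (allFuns n n) _ ⟩
      Σℚ.fold (allFuns n n) H                  ≡⟨ sym (Σℚ.fold-allFuns-adjSwap n n a H) ⟩
      Σℚ.fold (allFuns n n) (H ∘ adjSwapVec a) ≡⟨ Σℚ.fold-cong (allFuns n n) H-adjSwap ⟩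
      Σℚ.fold (allFuns n n) (λ w → - H w)      ≡⟨ sum-neg (allFuns n n) H ⟩
      - Σℚ.fold (allFuns n n) H                ≡⟨ cong -_ (sym (Σℚ.fold-filterᵇ (isPermᵇ r) (allFuns n n) _)) ⟩
      - Σℚ.fold (Sym n r) (λ w → act w Φ x)    ∎)

module RowFactors where

  open import Data.Rational using (_*_)
  open BoolReflection

  -- A family h describes the function y ↦ ∏ᵢ h i (y i) of the variables.
  RowFactor : Set
  RowFactor = ℕ → ℚ → ℚ

  infixl 7 _⊛_

  _⊛_ : RowFactor → RowFactor → RowFactor
  (h ⊛ h') c z = h c z * h' c z

  one : RowFactor
  one _ _ = 1ℚ

  mulAt : ℕ → (ℚ → ℚ) → RowFactor → RowFactor
  mulAt a φ h c z = if c ℕ.≡ᵇ a then φ z * h c z else h c z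

  ⊛-mulAt : ∀ j φ h R c z → (h ⊛ mulAt j φ R) c z ≡ mulAt j φ (h ⊛ R) c z
  ⊛-mulAt j φ h R c z with c ℕ.≡ᵇ j
  ... | true = solve 3 (λ a b c → a :* (b :* c) := b :* (a :* c)) refl (h c z) (φ z) (R c z)
  ... | false = refl

  mulAt-⊛-move : ∀ j φ h h' R c z → (h ⊛ mulAt j φ h' ⊛ R) c z ≡ (h ⊛ h' ⊛ mulAt j φ R) c z
  mulAt-⊛-move j φ h h' R c z with c ℕ.≡ᵇ j
  ... | true = solve 4 (λ a b c d → a :* (b :* c) :* d := a :* c :* (b :* d)) refl (h c z) (φ z) (h' c z) (R c z)
  ... | false = refl

  onRange : ℕ → ℕ → (ℚ → ℚ) → RowFactor
  onRange j zero φ = one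
  onRange j (suc k) φ = mulAt j φ (onRange (suc j) k φ)

  onRange-below : ∀ j k φ c z → c < j → onRange j k φ c z ≡ 1ℚ
  onRange-below j zero φ c z _ = refl
  onRange-below j (suc k) φ c z c<j =
    trans (if-false (c ℕ.≡ᵇ j) (≢⇒≡ᵇ-false c j (ℕP.<⇒≢ c<j)))
          (onRange-below (suc j) k φ c z (ℕP.<-trans c<j (ℕP.n<1+n j)))

  onRange-shift : ∀ j k φ c z → onRange (suc j) k φ (suc c) z ≡ onRange j k φ c z
  onRange-shift j zero φ c z = refl
  onRange-shift j (suc k) φ c z = cong (λ w → if c ℕ.≡ᵇ j then φ z * w else w) (onRange-shift (suc j) k φ c z)

  onRange-from-0 : ∀ k φ c z → onRange 0 k φ c z ≡ (if does (c ℕ.<? k) then φ z else 1ℚ)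
  onRange-from-0 zero φ c z = refl
  onRange-from-0 (suc k) φ zero z = trans (cong (φ z *_) (onRange-below 1 k φ 0 z z<s)) (ℚP.*-identityʳ _)
  onRange-from-0 (suc k) φ (suc c) z = trans (onRange-shift 0 k φ c z) (onRange-from-0 k φ c z)

module RowProducts (n r : ℕ) (β : ℚ) (x : Fin n → ℚ)
  (x-injective : ∀ i j → i ≢ j → x i ≢ x j) (1+βx≢0 : ∀ j → 1ℚ ℚ.+ β ℚ.* x j ≢ 0ℚ) (r≤n : r ≤ n) where

  open import Data.Rational using (_+_; _*_; _-_; -_)
  open AdjacentTransposition
  open RowFactors
  open Symmetrizer n r β x public
  open ≡-Reasoning

  rowProd : RowFactor → (Fin n → ℚ) → ℚ
  rowProd h y = Πℚ.foldFin (λ i → h (toℕ i) (y i))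

  rowProd-⊛ : ∀ h h' y → rowProd (h ⊛ h') y ≡ rowProd h y * rowProd h' y
  rowProd-⊛ h h' y = Πℚ.foldFin-∙ n (λ i → h (toℕ i) (y i)) (λ i → h' (toℕ i) (y i))

  T : RowFactor → ℚ
  T h = S (rowProd h)

  T-cong : ∀ h h' → (∀ c z → h c z ≡ h' c z) → T h ≡ T h'
  T-cong h h' e = S-cong _ _ (λ y → Πℚ.foldFin-cong (λ i → e (toℕ i) (y i)))

  rowProd-mulAt : ∀ a (a<n : a < n) φ h y → rowProd (mulAt a φ h) y ≡ φ (y (fromℕ< a<n)) * rowProd h y
  rowProd-mulAt a a<n φ h y = begin
    rowProd (mulAt a φ h) y
      ≡⟨ Πℚ.foldFin-cong (λ i → split (toℕ i ℕ.≡ᵇ a) (y i) (h (toℕ i) (y i))) ⟩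
    Πℚ.foldFin (λ i → (if toℕ i ℕ.≡ᵇ a then φ (y i) else 1ℚ) * h (toℕ i) (y i))
      ≡⟨ Πℚ.foldFin-∙ n _ _ ⟩
    Πℚ.foldFin (λ i → if toℕ i ℕ.≡ᵇ a then φ (y i) else 1ℚ) * rowProd h y
      ≡⟨ cong (_* rowProd h y) (Πℚ.foldFin-indicator n a a<n (φ ∘ y)) ⟩
    φ (y (fromℕ< a<n)) * rowProd h y ∎
    where
    split : ∀ b z w → (if b then φ z * w else w) ≡ (if b then φ z else 1ℚ) * w
    split true z w = refl
    split false z w = sym (ℚP.*-identityˡ w)

  rowProd-adjSwap : ∀ a → suc a < n → ∀ h → (∀ z → h a z ≡ h (suc a) z) → ∀ y → rowProd h (y ∘ adjSwap a) ≡ rowProd h y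
  rowProd-adjSwap a a+1<n h h-sym y = begin
    Πℚ.foldFin (λ i → h (toℕ i) (y (adjSwap a i)))
      ≡⟨ Πℚ.foldFin-cong (λ i → trans (h-adjSwap (toℕ i) (adjSwapView a (toℕ i)))
                                      (cong (λ c → h c (y (adjSwap a i))) (sym (toℕ-adjSwap a i a+1<n)))) ⟩
    Πℚ.foldFin ((λ i → h (toℕ i) (y i)) ∘ adjSwap a)
      ≡⟨ Πℚ.foldFin-adjSwap n a _ ⟩
    rowProd h y ∎
    where
    h-adjSwap : ∀ c {z} → AdjSwapView a c → h c z ≡ h (adjSwapℕ a c) z
    h-adjSwap c {z} (first refl) = trans (h-sym z) (cong (λ d → h d z) (sym (adjSwapℕ-first a)))
    h-adjSwap c {z} (second refl) = trans (sym (h-sym z)) (cong (λ d → h d z) (sym (adjSwapℕ-second a)))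
    h-adjSwap c {z} (other c≢a c≢a+1) = cong (λ d → h d z) (sym (adjSwapℕ-other a c c≢a c≢a+1))

  T-straighten : ∀ a → suc a < r → ∀ h → (∀ z → h a z ≡ h (suc a) z) → T h + β * T (mulAt a id h) ≡ 0ℚ
  T-straighten a a+1<r h h-sym = begin
    T h + β * T (mulAt a id h)
      ≡⟨ sym (S-linear (rowProd h) (rowProd (mulAt a id h)) β) ⟩
    S (λ y → rowProd h y + β * rowProd (mulAt a id h) y)
      ≡⟨ S-cong _ _ (λ y → trans (cong (λ w → rowProd h y + β * w) (rowProd-mulAt a a<n id h y))
           (solve 3 (λ P b u → P :+ b :* (u :* P) := P :* (con 1ℚ :+ b :* u)) refl (rowProd h y) β (y pos₀))) ⟩
    S (λ y → rowProd h y * (1ℚ + β * y pos₀))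
      ≡⟨ Vanishing.S-vanishes x-injective 1+βx≢0 a a+1<r r≤n (rowProd h)
           (λ y y' e → Πℚ.foldFin-cong (λ i → cong (h (toℕ i)) (e i))) (rowProd-adjSwap a a+1<n h h-sym) ⟩
    0ℚ ∎
    where open KernelSplitting n r β a a+1<r r≤n using (pos₀; a<n; a+1<n)

  T-mulAt-affine : ∀ j → j < n → (s : ℚ) → ∀ G → T (mulAt j (λ z → 1ℚ - s * z) G) ≡ T G - s * T (mulAt j id G)
  T-mulAt-affine j j<n s G = begin
    T (mulAt j (λ z → 1ℚ - s * z) G)
      ≡⟨ S-cong _ _ (λ y → begin
           rowProd (mulAt j (λ z → 1ℚ - s * z) G) y
             ≡⟨ rowProd-mulAt j j<n (λ z → 1ℚ - s * z) G y ⟩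
           (1ℚ - s * y (fromℕ< j<n)) * rowProd G y
             ≡⟨ solve 3 (λ s u P → (con 1ℚ :- s :* u) :* P := P :+ (:- s) :* (u :* P)) refl s (y (fromℕ< j<n)) (rowProd G y) ⟩
           rowProd G y + (- s) * (y (fromℕ< j<n) * rowProd G y)
             ≡⟨ cong (λ w → rowProd G y + (- s) * w) (sym (rowProd-mulAt j j<n id G y)) ⟩
           rowProd G y + (- s) * rowProd (mulAt j id G) y ∎) ⟩
    S (λ y → rowProd G y + (- s) * rowProd (mulAt j id G) y)
      ≡⟨ S-linear (rowProd G) (rowProd (mulAt j id G)) (- s) ⟩
    T G + (- s) * T (mulAt j id G)
      ≡⟨ solve 3 (λ A s B → A :+ (:- s) :* B := A :- s :* B) refl (T G) s _ ⟩
    T G - s * T (mulAt j id G) ∎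

module StaircaseExponent where

  open BoolReflection
  open ≡-Reasoning

  staircaseExp : ℕ → ℕ → ℕ → ℕ
  staircaseExp r q c = if does (c ℕ.<? r) then q ∸ c else 0

  staircaseExp-< : ∀ {r} q {c} → c < r → staircaseExp r q c ≡ q ∸ c
  staircaseExp-< {r} q {c} c<r = if-true (does (c ℕ.<? r)) (<?-true c<r)

  staircaseExp-≮ : ∀ {r} q {c} → ¬ c < r → staircaseExp r q c ≡ 0
  staircaseExp-≮ {r} q {c} c≮r = if-false (does (c ℕ.<? r)) (<?-false c≮r)

  staircaseExp-step : ∀ {r q} c → r ≤ q → suc c < r → staircaseExp r q c ≡ suc (staircaseExp r q (suc c))
  staircaseExp-step {r} {q} c r≤q c+1<r = begin
    staircaseExp r q c              ≡⟨ staircaseExp-< q (ℕP.<-trans (ℕP.n<1+n c) c+1<r) ⟩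
    q ∸ c                           ≡⟨ ℕP.+-∸-assoc 1 (ℕP.≤-trans (ℕP.<⇒≤ c+1<r) r≤q) ⟩
    suc (q ∸ suc c)                 ≡⟨ cong suc (sym (staircaseExp-< q c+1<r)) ⟩
    suc (staircaseExp r q (suc c))  ∎

module StaircaseExpansion (n r : ℕ) (β : ℚ) (x : Fin n → ℚ)
  (x-injective : ∀ i j → i ≢ j → x i ≢ x j) (1+βx≢0 : ∀ j → 1ℚ ℚ.+ β ℚ.* x j ≢ 0ℚ) (r≤n : r ≤ n)
  (q : ℕ) (r≤q : r ≤ q) where

  open import Data.Rational using (_+_; _*_; _-_; -_; ½)
  open BoolReflection
  open RationalFacts
  open RowFactors
  open RowProducts n r β x x-injective 1+βx≢0 r≤n public
  open StaircaseExponent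
  open ≡-Reasoning

  xμ : RowFactor
  xμ c z = pow z (staircaseExp r q c)

  two t : ℚ
  two = fromℕ 2
  t = (- β) ÷' two

  β≡-2t : β ≡ - (two * t)
  β≡-2t = trans (solve 1 (λ b → b := :- (con two :* ((:- b) :* con ½))) refl β)
                (cong (λ w → - (two * w)) (sym (÷'-by-inverse (- β) two ½ refl)))

  xRange : ℕ → ℕ → RowFactor
  xRange j k = onRange j k id

  tailFactors : ℕ → ℕ → RowFactor
  tailFactors j N = onRange j N (λ z → 1ℚ - t * z)

  AdjSymmetricFrom : ℕ → RowFactor → Set
  AdjSymmetricFrom j h = ∀ b → j ≤ b → suc b < r → ∀ z → h b z ≡ h (suc b) z

  -- Expanding (1 - t x_j) and applying the induction hypothesis to both terms leaves sums over
  -- x_{j+1} ⋯ x_{j+k+1}; since the exponents at j and j + 1 of μ differ by one, T-straighten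
  -- turns each of them into 2t times x_j ⋯ x_{j+k+1}, and the result telescopes.
  expansion : ∀ N j (hm : RowFactor) → j ℕ.+ N ≡ r → AdjSymmetricFrom j hm →
    T (xμ ⊛ hm ⊛ tailFactors j N)
      ≡ T (xμ ⊛ hm) - Σℚ.foldRange N (λ k → pow t (suc k) * T (xμ ⊛ hm ⊛ xRange j (suc k)))
  expansion zero j hm _ _ = begin
    T (xμ ⊛ hm ⊛ one)   ≡⟨ T-cong (xμ ⊛ hm ⊛ one) (xμ ⊛ hm) (λ c z → ℚP.*-identityʳ _) ⟩
    T (xμ ⊛ hm)         ≡⟨ solve 1 (λ P → P := P :- con 0ℚ) refl _ ⟩
    T (xμ ⊛ hm) - 0ℚ    ∎
  expansion (suc N) j hm j+N+1≡r hm-sym = begin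
    T (xμ ⊛ hm ⊛ tailFactors j (suc N))
      ≡⟨ T-cong _ _ (⊛-mulAt j (λ z → 1ℚ - t * z) (xμ ⊛ hm) (tailFactors (suc j) N)) ⟩
    T (mulAt j (λ z → 1ℚ - t * z) G)
      ≡⟨ T-mulAt-affine j j<n t G ⟩
    T G - t * T (mulAt j id G)
      ≡⟨ cong (λ w → T G - t * w) (T-cong _ _ (λ c z → trans
           (sym (⊛-mulAt j id (xμ ⊛ hm) (tailFactors (suc j) N) c z))
           (sym (mulAt-⊛-move j id xμ hm (tailFactors (suc j) N) c z)))) ⟩
    T G - t * T (xμ ⊛ hm' ⊛ tailFactors (suc j) N)
      ≡⟨ cong₂ (λ u v → u - t * v) (expansion N (suc j) hm j+1+N≡r (λ b j<b → hm-sym b (ℕP.<⇒≤ j<b)))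
                                   (expansion N (suc j) hm' j+1+N≡r hm'-sym) ⟩
    (T0 - ΣW) - t * (T (xμ ⊛ hm') - ΣW′)
      ≡⟨ cong₂ (λ u v → (T0 - u) - t * (v - ΣW′)) ΣW≡2tV Z₀ ⟩
    (T0 - two * (t * V)) - t * (Z 0 - ΣW′)
      ≡⟨ cong (λ w → (T0 - two * (t * V)) - t * (Z 0 - w)) (Σℚ.foldRange-cong N (λ k _ → cong (pow t (suc k) *_) (W′≡Z k))) ⟩
    (T0 - two * (t * V)) - t * (Z 0 - V)
      ≡⟨ solve 4 (λ T0 t V Z0 → (T0 :- con two :* (t :* V)) :- t :* (Z0 :- V) := T0 :- (t :* con 1ℚ :* Z0 :+ t :* V)) refl T0 t V (Z 0) ⟩
    T0 - (t * 1ℚ * Z 0 + t * V)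
      ≡⟨ cong (λ w → T0 - (t * 1ℚ * Z 0 + w)) (sym shifted-sum) ⟩
    T0 - Σℚ.foldRange (suc N) (λ k → pow t (suc k) * Z k) ∎
    where
    j+1+N≡r : suc j ℕ.+ N ≡ r
    j+1+N≡r = trans (sym (ℕP.+-suc j N)) j+N+1≡r
    j<r : j < r
    j<r = subst (j <_) j+N+1≡r (ℕP.m<m+n j z<s)
    j<n : j < n
    j<n = ℕP.<-≤-trans j<r r≤n
    G hm' : RowFactor
    G = xμ ⊛ hm ⊛ tailFactors (suc j) N
    hm' = mulAt j id hm
    T0 = T (xμ ⊛ hm)
    Z W W′ : ℕ → ℚ
    Z k = T (xμ ⊛ hm ⊛ xRange j (suc k))
    W k = T (xμ ⊛ hm ⊛ xRange (suc j) (suc k))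
    W′ k = T (xμ ⊛ hm' ⊛ xRange (suc j) (suc k))
    ΣW ΣW′ V : ℚ
    ΣW = Σℚ.foldRange N (λ k → pow t (suc k) * W k)
    ΣW′ = Σℚ.foldRange N (λ k → pow t (suc k) * W′ k)
    V = Σℚ.foldRange N (λ k → pow t (suc k) * Z (suc k))

    hm'-sym : AdjSymmetricFrom (suc j) hm'
    hm'-sym b j<b b+1<r z = begin
      hm' b z        ≡⟨ if-false (b ℕ.≡ᵇ j) (≢⇒≡ᵇ-false b j (ℕP.>⇒≢ j<b)) ⟩
      hm b z         ≡⟨ hm-sym b (ℕP.<⇒≤ j<b) b+1<r z ⟩
      hm (suc b) z   ≡⟨ sym (if-false (suc b ℕ.≡ᵇ j) (≢⇒≡ᵇ-false (suc b) j (ℕP.>⇒≢ (ℕP.<-trans j<b (ℕP.n<1+n b))))) ⟩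
      hm' (suc b) z  ∎

    Z₀ : T (xμ ⊛ hm') ≡ Z 0
    Z₀ = T-cong (xμ ⊛ hm') (xμ ⊛ hm ⊛ xRange j 1) (λ c z → trans (sym (ℚP.*-identityʳ _)) (mulAt-⊛-move j id xμ hm one c z))

    W′≡Z : ∀ k → W′ k ≡ Z (suc k)
    W′≡Z k = T-cong _ _ (mulAt-⊛-move j id xμ hm (xRange (suc j) (suc k)))

    W≡2tZ : ∀ k → k < N → W k ≡ two * t * Z (suc k)
    W≡2tZ k k<N = begin
      W k                                          ≡⟨ solve 3 (λ A b Z → A := (A :+ b :* Z) :- b :* Z) refl (W k) β (Z (suc k)) ⟩
      (W k + β * Z (suc k)) - β * Z (suc k)        ≡⟨ cong (λ w → (W k + β * w) - β * Z (suc k)) (sym Z-as-mulAt) ⟩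
      (W k + β * T (mulAt j id H)) - β * Z (suc k) ≡⟨ cong (_- β * Z (suc k)) (T-straighten j j+1<r H H-sym) ⟩
      0ℚ - β * Z (suc k)                           ≡⟨ cong (λ b → 0ℚ - b * Z (suc k)) β≡-2t ⟩
      0ℚ - (- (two * t)) * Z (suc k)
        ≡⟨ solve 3 (λ two t Z → con 0ℚ :- (:- (two :* t)) :* Z := two :* t :* Z) refl two t (Z (suc k)) ⟩
      two * t * Z (suc k)                          ∎
      where
      H : RowFactor
      H = xμ ⊛ hm ⊛ xRange (suc j) (suc k)
      j+1<r : suc j < r
      j+1<r = subst (suc j <_) j+1+N≡r (ℕP.m<m+n (suc j) (ℕP.<-≤-trans z<s k<N))
      Z-as-mulAt : T (mulAt j id H) ≡ Z (suc k)
      Z-as-mulAt = T-cong _ _ (λ c z → sym (⊛-mulAt j id (xμ ⊛ hm) (xRange (suc j) (suc k)) c z))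
      H-sym : ∀ z → H j z ≡ H (suc j) z
      H-sym z = begin
        pow z (staircaseExp r q j) * hm j z * xRange (suc j) (suc k) j z
          ≡⟨ cong₂ (λ m w → pow z m * w * xRange (suc j) (suc k) j z) (staircaseExp-step j r≤q j+1<r) (hm-sym j ℕP.≤-refl j+1<r z) ⟩
        z * pow z e₁ * hm (suc j) z * xRange (suc j) (suc k) j z
          ≡⟨ cong (z * pow z e₁ * hm (suc j) z *_) (onRange-below (suc j) (suc k) id j z (ℕP.n<1+n j)) ⟩
        z * pow z e₁ * hm (suc j) z * 1ℚ
          ≡⟨ solve 3 (λ z P h → z :* P :* h :* con 1ℚ := P :* h :* (z :* con 1ℚ)) refl z (pow z e₁) (hm (suc j) z) ⟩
        pow z e₁ * hm (suc j) z * (z * 1ℚ)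
          ≡⟨ cong (λ w → pow z e₁ * hm (suc j) z * w) (sym (trans
               (if-true (suc j ℕ.≡ᵇ suc j) (≡ᵇ-refl (suc j)))
               (cong (z *_) (onRange-below (suc (suc j)) k id (suc j) z (ℕP.n<1+n (suc j)))))) ⟩
        H (suc j) z ∎
        where e₁ = staircaseExp r q (suc j)

    ΣW≡2tV : ΣW ≡ two * (t * V)
    ΣW≡2tV = begin
      ΣW  ≡⟨ Σℚ.foldRange-cong N (λ k k<N → trans (cong (pow t (suc k) *_) (W≡2tZ k k<N))
               (solve 4 (λ p two t Z → p :* (two :* t :* Z) := two :* (t :* (p :* Z))) refl (pow t (suc k)) two t (Z (suc k)))) ⟩
      Σℚ.foldRange N (λ k → two * (t * (pow t (suc k) * Z (suc k))))  ≡⟨ sumRange-*ˡ N two _ ⟩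
      two * Σℚ.foldRange N (λ k → t * (pow t (suc k) * Z (suc k)))    ≡⟨ cong (two *_) (sumRange-*ˡ N t _) ⟩
      two * (t * V)  ∎

    shifted-sum : Σℚ.foldRange N (λ k → pow t (suc (suc k)) * Z (suc k)) ≡ t * V
    shifted-sum = trans (Σℚ.foldRange-cong N (λ k _ → ℚP.*-assoc t (pow t (suc k)) (Z (suc k)))) (sumRange-*ˡ N t _)

  expansion-from-0 : T (xμ ⊛ tailFactors 0 r)
    ≡ T xμ - Σℚ.foldRange r (λ k → pow t (suc k) * T (xμ ⊛ xRange 0 (suc k)))
  expansion-from-0 = begin
    T (xμ ⊛ tailFactors 0 r)
      ≡⟨ sym (drop-one (tailFactors 0 r)) ⟩
    T (xμ ⊛ one ⊛ tailFactors 0 r)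
      ≡⟨ expansion r 0 one refl (λ _ _ _ _ → refl) ⟩
    T (xμ ⊛ one) - Σℚ.foldRange r (λ k → pow t (suc k) * T (xμ ⊛ one ⊛ xRange 0 (suc k)))
      ≡⟨ cong₂ (λ u v → u - v) (T-cong (xμ ⊛ one) xμ (λ c z → ℚP.*-identityʳ (xμ c z)))
                               (Σℚ.foldRange-cong r (λ k _ → cong (pow t (suc k) *_) (drop-one (xRange 0 (suc k))))) ⟩
    T xμ - Σℚ.foldRange r (λ k → pow t (suc k) * T (xμ ⊛ xRange 0 (suc k))) ∎
    where
    drop-one : ∀ h → T (xμ ⊛ one ⊛ h) ≡ T (xμ ⊛ h)
    drop-one h = T-cong (xμ ⊛ one ⊛ h) (xμ ⊛ h) (λ c z → cong (_* h c z) (ℚP.*-identityʳ (xμ c z)))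

module Counting where

  open import Data.Nat using (_+_)

  length-filterᵇ : ∀ {A : Set} (P : A → Bool) (xs : List A) →
    length (filterᵇ P xs) ≡ Σℕ.fold xs (λ x → if P x then 1 else 0)
  length-filterᵇ P [] = refl
  length-filterᵇ P (x ∷ xs) with P x
  ... | true = cong suc (length-filterᵇ P xs)
  ... | false = length-filterᵇ P xs

  foldRange-1 : ∀ N → Σℕ.foldRange N (λ _ → 1) ≡ N
  foldRange-1 zero = refl
  foldRange-1 (suc N) = cong suc (foldRange-1 N)

  count-interval : ∀ C lo hi (P : ℕ → Bool) →
    (∀ j → P j ≡ true → lo ≤ j × j < hi) → (∀ j → lo ≤ j → j < hi → P j ≡ true) → hi ≤ C →
    Σℕ.foldRange C (λ j → if P j then 1 else 0) ≡ hi ∸ lo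
  count-interval C lo zero P P⇒in _ _ =
    trans (Σℕ.foldRange-cong C (λ j _ → outside j)) (trans (Σℕ.foldRange-ε C) (sym (ℕP.0∸n≡0 lo)))
    where
    outside : ∀ j → (if P j then 1 else 0) ≡ 0
    outside j with P j in e
    ... | true = ⊥-elim (ℕP.n≮0 (proj₂ (P⇒in j e)))
    ... | false = refl
  count-interval (suc C) zero (suc h) P P⇒in in⇒P (s≤s h≤C) =
    cong₂ _+_ (cong (λ b → if b then 1 else 0) (in⇒P 0 z≤n z<s))
              (count-interval C zero h (P ∘ suc) (λ j e → z≤n , ℕP.≤-pred (proj₂ (P⇒in (suc j) e)))
                              (λ j _ p → in⇒P (suc j) z≤n (s<s p)) h≤C)
  count-interval (suc C) (suc l) (suc h) P P⇒in in⇒P (s≤s h≤C) =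
    cong₂ _+_ P0≡0 (count-interval C l h (P ∘ suc)
                      (λ j e → ℕP.≤-pred (proj₁ (P⇒in (suc j) e)) , ℕP.≤-pred (proj₂ (P⇒in (suc j) e)))
                      (λ j p q → in⇒P (suc j) (s≤s p) (s<s q)) h≤C)
    where
    P0≡0 : (if P 0 then 1 else 0) ≡ 0
    P0≡0 with P 0 in e
    ... | true with proj₁ (P⇒in 0 e)
    ...   | ()
    P0≡0 | false = refl

  foldFin-⊔-lub : ∀ {n} (f : Fin n → ℕ) b → (∀ i → f i ≤ b) → Maxℕ.foldFin f ≤ b
  foldFin-⊔-lub {zero} f b h = z≤n
  foldFin-⊔-lub {suc n} f b h = ℕP.⊔-lub (h Fin.zero) (foldFin-⊔-lub (f ∘ Fin.suc) b (h ∘ Fin.suc))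

  foldFin-⊔-upper : ∀ {n} (f : Fin n → ℕ) i → f i ≤ Maxℕ.foldFin f
  foldFin-⊔-upper f Fin.zero = ℕP.m≤m⊔n _ _
  foldFin-⊔-upper f (Fin.suc i) = ℕP.≤-trans (foldFin-⊔-upper (f ∘ Fin.suc) i) (ℕP.m≤n⊔m _ _)

  foldFin-+-mono : ∀ {n} (f g : Fin n → ℕ) → (∀ i → f i ≤ g i) → Σℕ.foldFin f ≤ Σℕ.foldFin g
  foldFin-+-mono {zero} f g h = z≤n
  foldFin-+-mono {suc n} f g h = ℕP.+-mono-≤ (h Fin.zero) (foldFin-+-mono (f ∘ Fin.suc) (g ∘ Fin.suc) (h ∘ Fin.suc))

  lookup≤sum : ∀ {m} (v : Vec ℕ m) (i : Fin m) → lookup v i ≤ Vec.sum v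
  lookup≤sum (a ∷ v) Fin.zero = ℕP.m≤m+n a _
  lookup≤sum (a ∷ v) (Fin.suc i) = ℕP.≤-trans (lookup≤sum v i) (ℕP.m≤n+m _ a)

module ShiftedDiagrams where

  open import Data.Nat using (_+_; _⊔_)
  open BoolReflection
  open Counting
  open ≡-Reasoning

  module _ {n : ℕ} (lam mu : Vec ℕ n) (i : Fin n) where

    private
      s = suc (toℕ i)

    inSkewᵇ⇒ : ∀ j → inSkewᵇ lam mu i j ≡ true → s + lookup mu i ≤ j × j < s + lookup lam i
    inSkewᵇ⇒ j e = ℕP.≮⇒≥ not-in-mu , <?-true⁻ (∧-elimʳ {does (s ℕ.≤? j)} in-lam)
      where
      in-lam = ∧-elimˡ {inSDᵇ lam i j} e
      not-in-mu : ¬ j < s + lookup mu i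
      not-in-mu j<s+μ with trans (sym (not-elim (∧-elimʳ {inSDᵇ lam i j} e)))
                                 (∧-intro (≤?-true {s} {j} (≤?-true⁻ (∧-elimˡ {does (s ℕ.≤? j)} in-lam))) (<?-true j<s+μ))
      ... | ()

    ⇒inSkewᵇ : ∀ j → s + lookup mu i ≤ j → j < s + lookup lam i → inSkewᵇ lam mu i j ≡ true
    ⇒inSkewᵇ j s+μ≤j j<s+λ =
      ∧-intro (∧-intro (≤?-true (ℕP.≤-trans (ℕP.m≤m+n s _) s+μ≤j)) (<?-true j<s+λ))
              (not-intro (∧-falseʳ (does (s ℕ.≤? j)) (<?-false (ℕP.≤⇒≯ s+μ≤j))))

    rowCount≡∸ : lookup mu i ≤ lookup lam i → rowCount lam mu i ≡ lookup lam i ∸ lookup mu i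
    rowCount≡∸ μ≤λ = begin
      rowCount lam mu i
        ≡⟨ length-filterᵇ (inSkewᵇ lam mu i) (upTo (colBound lam)) ⟩
      Σℕ.fold (upTo (colBound lam)) indicator
        ≡⟨ Σℕ.fold-upTo (colBound lam) indicator ⟩
      Σℕ.foldRange (colBound lam) indicator
        ≡⟨ count-interval (colBound lam) (s + lookup mu i) (s + lookup lam i) (inSkewᵇ lam mu i) inSkewᵇ⇒ ⇒inSkewᵇ s+λ≤C ⟩
      (s + lookup lam i) ∸ (s + lookup mu i)
        ≡⟨ ℕP.[m+n]∸[m+o]≡n∸o s (lookup lam i) (lookup mu i) ⟩
      lookup lam i ∸ lookup mu i ∎
      where
      indicator : ℕ → ℕ
      indicator j = if inSkewᵇ lam mu i j then 1 else 0
      s+λ≤C : s + lookup lam i ≤ colBound lam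
      s+λ≤C = s≤s (ℕP.+-mono-≤ (ℕP.<⇒≤ (FinP.toℕ<n i)) (lookup≤sum lam i))

  module _ {n r : ℕ} (r≤n : r ≤ n) (0<r : 0 < r) (lam : Vec ℕ n)
    (nonzero : ∀ i → toℕ i < r → lookup lam i ≢ 0) (zero-from : ∀ i → ¬ toℕ i < r → lookup lam i ≡ 0) where

    private
      g : Fin n → ℕ
      g i = if does (lookup lam i ℕ.≟ 0) then 0 else suc (toℕ i)

      g-< : ∀ i → toℕ i < r → g i ≡ suc (toℕ i)
      g-< i i<r = if-false (does (lookup lam i ℕ.≟ 0)) (dec-false (lookup lam i ℕ.≟ 0) (nonzero i i<r))

      g-≮ : ∀ i → ¬ toℕ i < r → g i ≡ 0
      g-≮ i i≮r = if-true (does (lookup lam i ℕ.≟ 0)) (dec-true (lookup lam i ℕ.≟ 0) (zero-from i i≮r))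

    maxNZ≡ : maxNZ lam ≡ r
    maxNZ≡ = ℕP.≤-antisym (subst (_≤ r) (sym maxNZ-fold) (foldFin-⊔-lub g r g≤r))
                          (subst (r ≤_) (sym maxNZ-fold) (ℕP.≤-trans (ℕP.≤-reflexive (sym g-last)) (foldFin-⊔-upper g last)))
      where
      maxNZ-fold : maxNZ lam ≡ Maxℕ.foldFin g
      maxNZ-fold = trans (ListP.foldr-map _⊔_ g 0 (allFin n)) (Maxℕ.fold-allFin n g)
      g≤r : ∀ i → g i ≤ r
      g≤r i with toℕ i ℕ.<? r
      ... | yes i<r = ℕP.≤-trans (ℕP.≤-reflexive (g-< i i<r)) i<r
      ... | no i≮r = subst (_≤ r) (sym (g-≮ i i≮r)) z≤n
      r-1+1≡r : suc (ℕ.pred r) ≡ r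
      r-1+1≡r = ℕP.suc-pred r {{ℕ.>-nonZero 0<r}}
      r-1<n : ℕ.pred r < n
      r-1<n = ℕP.<-≤-trans (subst (ℕ.pred r <_) r-1+1≡r (ℕP.n<1+n _)) r≤n
      last : Fin n
      last = fromℕ< r-1<n
      g-last : g last ≡ r
      g-last = trans (g-< last (subst (_< r) (sym (FinP.toℕ-fromℕ< r-1<n)) (subst (ℕ.pred r <_) r-1+1≡r (ℕP.n<1+n _))))
                     (trans (cong suc (FinP.toℕ-fromℕ< r-1<n)) r-1+1≡r)

    len≡ : len lam ≡ r
    len≡ = begin
      len lam
        ≡⟨ length-filterᵇ _ (allFin n) ⟩
      Σℕ.fold (allFin n) isNonzero
        ≡⟨ Σℕ.fold-allFin n isNonzero ⟩
      Σℕ.foldFin isNonzero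
        ≡⟨ Σℕ.foldFin-cong isNonzero≡ ⟩
      Σℕ.foldFin {n} (λ i → if does (toℕ i ℕ.<? r) then 1 else 0)
        ≡⟨ Σℕ.foldFin-prefix n r r≤n 1 ⟩
      Σℕ.foldRange r (λ _ → 1)
        ≡⟨ foldRange-1 r ⟩
      r ∎
      where
      isNonzero : Fin n → ℕ
      isNonzero i = if not (does (lookup lam i ℕ.≟ 0)) then 1 else 0
      isNonzero≡ : ∀ i → isNonzero i ≡ (if does (toℕ i ℕ.<? r) then 1 else 0)
      isNonzero≡ i with toℕ i ℕ.<? r
      ... | yes i<r = trans (if-true (not (does (lookup lam i ℕ.≟ 0))) (not-intro (dec-false (lookup lam i ℕ.≟ 0) (nonzero i i<r))))
                            (sym (if-true (does (toℕ i ℕ.<? r)) (<?-true i<r)))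
      ... | no i≮r = trans (if-false (not (does (lookup lam i ℕ.≟ 0))) (cong not (dec-true (lookup lam i ℕ.≟ 0) (zero-from i i≮r))))
                           (sym (if-false (does (toℕ i ℕ.<? r)) (<?-false i≮r)))

module StaircaseShape (n q p : ℕ) (0<p : 0 < p) (p≤q : p ≤ q) (r≤n : suc (q ∸ p) ≤ n) where

  open import Data.Nat using (_+_)
  open BoolReflection
  open Counting
  open ShiftedDiagrams
  open StaircaseExponent

  r : ℕ
  r = suc (q ∸ p)

  μ : Vec ℕ n
  μ = staircase n q p

  e : ℕ → ℕ
  e = staircaseExp r q

  below : ℕ → ℕ → ℕ
  below k c = if does (c ℕ.<? k) then 1 else 0

  raise : ℕ → Vec ℕ n
  raise k = tabulate (λ i → e (toℕ i) + below k (toℕ i))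

  r≤q : r ≤ q
  r≤q = ℕP.∸-monoʳ-< {q} {p} {0} 0<p p≤q

  lookup-μ : ∀ i → lookup μ i ≡ e (toℕ i)
  lookup-μ i = VecP.lookup∘tabulate _ i

  lookup-raise : ∀ k i → lookup (raise k) i ≡ e (toℕ i) + below k (toℕ i)
  lookup-raise k i = VecP.lookup∘tabulate _ i

  e-pos : ∀ c → c < r → 0 < e c
  e-pos c c<r = subst (0 <_) (sym (staircaseExp-< q c<r))
    (ℕP.<-≤-trans 0<p (subst (_≤ q ∸ c) (ℕP.m∸[m∸n]≡n p≤q) (ℕP.∸-monoʳ-≤ q (ℕP.≤-pred c<r))))

  row-end : ∀ c → c < r → suc c + e c ≡ suc q
  row-end c c<r = cong suc (trans (cong (c +_) (staircaseExp-< q c<r)) (ℕP.m+[n∸m]≡n (ℕP.≤-trans (ℕP.<⇒≤ c<r) r≤q)))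

  below≤1 : ∀ k c → below k c ≤ 1
  below≤1 k c with does (c ℕ.<? k)
  ... | true = ℕP.≤-refl
  ... | false = z≤n

  below-< : ∀ k c → c < k → below k c ≡ 1
  below-< k c c<k = if-true (does (c ℕ.<? k)) (<?-true c<k)

  below-≮ : ∀ k c → ¬ c < k → below k c ≡ 0
  below-≮ k c c≮k = if-false (does (c ℕ.<? k)) (<?-false c≮k)

  below-antitone : ∀ k c d → c ≤ d → below k d ≤ below k c
  below-antitone k c d c≤d with d ℕ.<? k
  ... | yes d<k = ℕP.≤-reflexive (trans (below-< k d d<k) (sym (below-< k c (ℕP.≤-<-trans c≤d d<k))))
  ... | no d≮k = ℕP.≤-trans (ℕP.≤-reflexive (below-≮ k d d≮k)) z≤n

  μ-nonzero : ∀ i → toℕ i < r → lookup μ i ≢ 0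
  μ-nonzero i i<r μᵢ≡0 = ℕP.<⇒≢ (e-pos (toℕ i) i<r) (sym (trans (sym (lookup-μ i)) μᵢ≡0))

  μ-zero-from : ∀ i → ¬ toℕ i < r → lookup μ i ≡ 0
  μ-zero-from i i≮r = trans (lookup-μ i) (staircaseExp-≮ q i≮r)

  module _ (k : ℕ) (k≤r : k ≤ r) where

    raise-nonzero : ∀ i → toℕ i < r → lookup (raise k) i ≢ 0
    raise-nonzero i i<r λᵢ≡0 =
      ℕP.<⇒≢ (ℕP.<-≤-trans (e-pos (toℕ i) i<r) (ℕP.m≤m+n _ _)) (sym (trans (sym (lookup-raise k i)) λᵢ≡0))

    raise-zero-from : ∀ i → ¬ toℕ i < r → lookup (raise k) i ≡ 0
    raise-zero-from i i≮r = trans (lookup-raise k i)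
      (cong₂ _+_ (staircaseExp-≮ q i≮r) (below-≮ k (toℕ i) (λ i<k → i≮r (ℕP.<-≤-trans i<k k≤r))))

  maxNZ-μ : maxNZ μ ≡ r
  maxNZ-μ = maxNZ≡ r≤n z<s μ μ-nonzero μ-zero-from

  len-μ : len μ ≡ r
  len-μ = len≡ r≤n z<s μ μ-nonzero μ-zero-from

  maxNZ-raise : ∀ k → k ≤ r → maxNZ (raise k) ≡ r
  maxNZ-raise k k≤r = maxNZ≡ r≤n z<s (raise k) (raise-nonzero k k≤r) (raise-zero-from k k≤r)

  len-raise : ∀ k → k ≤ r → len (raise k) ≡ r
  len-raise k k≤r = len≡ r≤n z<s (raise k) (raise-nonzero k k≤r) (raise-zero-from k k≤r)

  μ≤raise : ∀ k i → lookup μ i ≤ lookup (raise k) i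
  μ≤raise k i = subst₂ _≤_ (sym (lookup-μ i)) (sym (lookup-raise k i)) (ℕP.m≤m+n _ _)

  rowCount-raise : ∀ k i → rowCount (raise k) μ i ≡ below k (toℕ i)
  rowCount-raise k i = trans (rowCount≡∸ (raise k) μ i (μ≤raise k i))
    (trans (cong₂ _∸_ (lookup-raise k i) (lookup-μ i)) (ℕP.m+n∸m≡n (e (toℕ i)) (below k (toℕ i))))

  skewSize-raise : ∀ k → k ≤ r → skewSize (raise k) μ ≡ k
  skewSize-raise k k≤r = begin
    skewSize (raise k) μ                    ≡⟨ ListP.foldr-map _+_ (rowCount (raise k) μ) 0 (allFin n) ⟩
    Σℕ.fold (allFin n) (rowCount (raise k) μ) ≡⟨ Σℕ.fold-allFin n _ ⟩
    Σℕ.foldFin (rowCount (raise k) μ)       ≡⟨ Σℕ.foldFin-cong (rowCount-raise k) ⟩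
    Σℕ.foldFin {n} (λ i → below k (toℕ i))  ≡⟨ Σℕ.foldFin-prefix n k (ℕP.≤-trans k≤r r≤n) 1 ⟩
    Σℕ.foldRange k (λ _ → 1)                ≡⟨ foldRange-1 k ⟩
    k                                       ∎
    where
    open ≡-Reasoning

  0<n : 0 < n
  0<n = ℕP.<-≤-trans z<s r≤n

  first : Fin n
  first = fromℕ< 0<n

  toℕ-first : toℕ first ≡ 0
  toℕ-first = FinP.toℕ-fromℕ< 0<n

  e-first : e (toℕ first) ≡ q
  e-first = trans (cong e toℕ-first) (staircaseExp-< {r} q z<s)

  inSkewColumnᵇ : Vec ℕ n → ℕ → Bool
  inSkewColumnᵇ lam j = or (map (λ i → inSkewᵇ lam μ i j) (allFin n))

  cols-as-count : ∀ lam → cols lam μ ≡ Σℕ.foldRange (colBound lam) (λ j → if inSkewColumnᵇ lam j then 1 else 0)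
  cols-as-count lam = trans (length-filterᵇ (inSkewColumnᵇ lam) (upTo (colBound lam)))
                            (Σℕ.fold-upTo (colBound lam) (λ j → if inSkewColumnᵇ lam j then 1 else 0))

  cols-raise-0 : cols (raise 0) μ ≡ 0
  cols-raise-0 = trans (cols-as-count (raise 0)) (count-interval (colBound (raise 0)) 0 0 _ no-column (λ _ _ ()) z≤n)
    where
    no-column : ∀ j → inSkewColumnᵇ (raise 0) j ≡ true → 0 ≤ j × j < 0
    no-column j hit with or-allFin⁻ n (λ i → inSkewᵇ (raise 0) μ i j) hit
    ... | i , inSkew with inSkewᵇ⇒ (raise 0) μ i j inSkew
    ... | (μ-end≤j , j<λ-end) = ⊥-elim (ℕP.<⇒≱ j<λ-end (subst (λ w → suc (toℕ i) + w ≤ j) μᵢ≡λᵢ μ-end≤j))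
      where
      μᵢ≡λᵢ : lookup μ i ≡ lookup (raise 0) i
      μᵢ≡λᵢ = trans (lookup-μ i) (sym (trans (lookup-raise 0 i) (ℕP.+-identityʳ _)))

  -- All added boxes lie in column q + 1.
  cols-raise-suc : ∀ k → suc k ≤ r → cols (raise (suc k)) μ ≡ 1
  cols-raise-suc k k+1≤r = trans (cols-as-count λ′)
    (trans (count-interval (colBound λ′) (suc q) (suc (suc q)) _ column-q+1 ⇒column λ-end≤C) (ℕP.m+n∸n≡m 1 (suc q)))
    where
    λ′ = raise (suc k)
    λ′-first : lookup λ′ first ≡ suc q
    λ′-first = trans (lookup-raise (suc k) first)
      (trans (cong₂ _+_ e-first (trans (cong (below (suc k)) toℕ-first) (below-< (suc k) 0 z<s))) (ℕP.+-comm q 1))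
    column-q+1 : ∀ j → inSkewColumnᵇ λ′ j ≡ true → suc q ≤ j × j < suc (suc q)
    column-q+1 j hit with or-allFin⁻ n (λ i → inSkewᵇ λ′ μ i j) hit
    ... | i , inSkew with inSkewᵇ⇒ λ′ μ i j inSkew | toℕ i ℕ.<? r
    ... | (μ-end≤j , j<λ-end) | yes i<r =
          subst (_≤ j) (trans (cong (suc (toℕ i) +_) (lookup-μ i)) (row-end (toℕ i) i<r)) μ-end≤j ,
          ℕP.<-≤-trans j<λ-end (begin
            suc (toℕ i) + lookup λ′ i                   ≡⟨ cong (suc (toℕ i) +_) (lookup-raise (suc k) i) ⟩
            suc (toℕ i) + (e (toℕ i) + below (suc k) (toℕ i))
              ≤⟨ ℕP.+-monoʳ-≤ (suc (toℕ i)) (ℕP.+-monoʳ-≤ (e (toℕ i)) (below≤1 (suc k) (toℕ i))) ⟩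
            suc (toℕ i) + (e (toℕ i) + 1)               ≡⟨ sym (ℕP.+-assoc (suc (toℕ i)) (e (toℕ i)) 1) ⟩
            suc (toℕ i) + e (toℕ i) + 1                 ≡⟨ cong (_+ 1) (row-end (toℕ i) i<r) ⟩
            suc q + 1                                   ≡⟨ ℕP.+-comm (suc q) 1 ⟩
            suc (suc q)                                 ∎)
      where open ℕP.≤-Reasoning
    ... | (μ-end≤j , j<λ-end) | no i≮r = ⊥-elim (ℕP.<⇒≱ j<λ-end (subst (λ w → suc (toℕ i) + w ≤ j)
            (trans (μ-zero-from i i≮r) (sym (raise-zero-from (suc k) k+1≤r i i≮r))) μ-end≤j))
    ⇒column : ∀ j → suc q ≤ j → j < suc (suc q) → inSkewColumnᵇ λ′ j ≡ true
    ⇒column j q+1≤j j<q+2 = or-allFin⁺ n (λ i → inSkewᵇ λ′ μ i j) first (⇒inSkewᵇ λ′ μ first j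
      (subst (_≤ j) (sym (cong₂ (λ c w → suc c + w) toℕ-first (trans (lookup-μ first) e-first))) q+1≤j)
      (subst (j <_) (sym (cong₂ (λ c w → suc c + w) toℕ-first λ′-first)) j<q+2))
    λ-end≤C : suc (suc q) ≤ colBound λ′
    λ-end≤C = s≤s (ℕP.≤-trans (ℕP.≤-trans (ℕP.≤-reflexive (sym λ′-first)) (lookup≤sum λ′ first)) (ℕP.m≤n+m _ n))

  IsStrict : Vec ℕ n → Set
  IsStrict lam = ∀ i j → suc (toℕ i) ≡ toℕ j → lookup lam j ≡ 0 ⊎ lookup lam j < lookup lam i

  isStrictᵇ⇒ : ∀ lam → isStrictᵇ lam ≡ true → IsStrict lam
  isStrictᵇ⇒ lam strict i j i+1≡j = decode (suc (toℕ i) ℕ.≟ toℕ j) (and-allFin⁻ n _ (and-allFin⁻ n _ strict i) j)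
    where
    decode : (d : Dec (suc (toℕ i) ≡ toℕ j)) →
      (not (does d) ∨ does (lookup lam j ℕ.≟ 0) ∨ does (lookup lam j ℕ.<? lookup lam i)) ≡ true →
      lookup lam j ≡ 0 ⊎ lookup lam j < lookup lam i
    decode (false because ofⁿ ≢) _ = ⊥-elim (≢ i+1≡j)
    decode (true because _) entry = does-∨⁻ (lookup lam j ℕ.≟ 0) (lookup lam j ℕ.<? lookup lam i) entry

  ⇒isStrictᵇ : ∀ lam → IsStrict lam → isStrictᵇ lam ≡ true
  ⇒isStrictᵇ lam h = and-allFin⁺ n _ (λ i → and-allFin⁺ n _ (λ j → encode i j (suc (toℕ i) ℕ.≟ toℕ j)))
    where
    encode : ∀ i j (d : Dec (suc (toℕ i) ≡ toℕ j)) →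
      (not (does d) ∨ does (lookup lam j ℕ.≟ 0) ∨ does (lookup lam j ℕ.<? lookup lam i)) ≡ true
    encode i j (false because _) = refl
    encode i j (true because ofʸ i+1≡j) = does-∨⁺ (lookup lam j ℕ.≟ 0) (lookup lam j ℕ.<? lookup lam i) (h i j i+1≡j)

  raise-strict : ∀ k → k ≤ r → IsStrict (raise k)
  raise-strict k k≤r i j i+1≡j with toℕ j ℕ.<? r
  ... | no j≮r = inj₁ (raise-zero-from k k≤r j j≮r)
  ... | yes j<r = inj₂ (subst₂ _<_ (sym (lookup-raise k j)) (sym (lookup-raise k i)) decreasing)
    where
    c = toℕ i
    d = toℕ j
    decreasing : e d + below k d < e c + below k c
    decreasing = ℕP.≤-trans (s≤s (ℕP.+-monoʳ-≤ (e d) (below-antitone k c d (subst (c ≤_) i+1≡j (ℕP.n≤1+n c)))))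
      (ℕP.≤-reflexive (cong (_+ below k c)
        (trans (cong (λ w → suc (e w)) (sym i+1≡j)) (sym (staircaseExp-step c r≤q (subst (_< r) (sym i+1≡j) j<r))))))

  raise-valid : ∀ k → k ≤ r → validᵇ μ (raise k) ≡ true
  raise-valid k k≤r = ∧-intro (⇒isStrictᵇ (raise k) (raise-strict k k≤r))
    (∧-intro (and-allFin⁺ n _ (λ i → ≤?-true (μ≤raise k i)))
    (∧-intro (dec-true (len (raise k) ℕ.≟ len μ) (trans (len-raise k k≤r) (sym len-μ)))
             (and-allFin⁺ n _ (λ i → ≤?-true (subst (_≤ 1) (sym (rowCount-raise k i)) (below≤1 k (toℕ i)))))))

module BoxEnumeration where

  open BoolReflection
  open ≡-Reasoning

  vecEqᵇ : ∀ {m} → Vec ℕ m → Vec ℕ m → Bool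
  vecEqᵇ [] [] = true
  vecEqᵇ (a ∷ u) (b ∷ w) = (a ℕ.≡ᵇ b) ∧ vecEqᵇ u w

  vecEqᵇ⇒≡ : ∀ {m} (u w : Vec ℕ m) → vecEqᵇ u w ≡ true → u ≡ w
  vecEqᵇ⇒≡ [] [] _ = refl
  vecEqᵇ⇒≡ (a ∷ u) (b ∷ w) e =
    cong₂ _∷_ (≡ᵇ-true⇒≡ a b (∧-elimˡ {a ℕ.≡ᵇ b} e)) (vecEqᵇ⇒≡ u w (∧-elimʳ {a ℕ.≡ᵇ b} e))

  vecEqᵇ-refl : ∀ {m} (u : Vec ℕ m) → vecEqᵇ u u ≡ true
  vecEqᵇ-refl [] = refl
  vecEqᵇ-refl (a ∷ u) = ∧-intro (≡ᵇ-refl a) (vecEqᵇ-refl u)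

  ≢⇒vecEqᵇ-false : ∀ {m} (u w : Vec ℕ m) → u ≢ w → vecEqᵇ u w ≡ false
  ≢⇒vecEqᵇ-false u w u≢w with vecEqᵇ u w in e
  ... | true = ⊥-elim (u≢w (vecEqᵇ⇒≡ u w e))
  ... | false = refl

  sum-boxVecs-indicator : ∀ m b (w : Vec ℕ m) → (∀ i → lookup w i ≤ b) → (c : ℚ) →
    Σℚ.fold (boxVecs m b) (λ lam → if vecEqᵇ lam w then c else 0ℚ) ≡ c
  sum-boxVecs-indicator zero b [] _ c = ℚP.+-identityʳ c
  sum-boxVecs-indicator (suc m) b (w₀ ∷ w) w≤b c = begin
    Σℚ.fold (concatMap (λ v → map (λ a → a ∷ v) (upTo (suc b))) (boxVecs m b)) F
      ≡⟨ Σℚ.fold-concatMap (boxVecs m b) _ F ⟩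
    Σℚ.fold (boxVecs m b) (λ v → Σℚ.fold (map (λ a → a ∷ v) (upTo (suc b))) F)
      ≡⟨ Σℚ.fold-cong (boxVecs m b) (λ v → Σℚ.fold-map (upTo (suc b)) (λ a → a ∷ v) F) ⟩
    Σℚ.fold (boxVecs m b) (λ v → Σℚ.fold (upTo (suc b)) (λ a → F (a ∷ v)))
      ≡⟨ Σℚ.fold-cong (boxVecs m b) (λ v → trans (Σℚ.fold-cong (upTo (suc b)) (λ a → if-∧ (a ℕ.≡ᵇ w₀) (vecEqᵇ v w) {c} {0ℚ}))
           (Σℚ.fold-if (upTo (suc b)) (vecEqᵇ v w) first-entry)) ⟩
    Σℚ.fold (boxVecs m b) (λ v → if vecEqᵇ v w then Σℚ.fold (upTo (suc b)) first-entry else 0ℚ)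
      ≡⟨ Σℚ.fold-cong (boxVecs m b) (λ v → cong (λ z → if vecEqᵇ v w then z else 0ℚ)
           (trans (Σℚ.fold-upTo (suc b) first-entry) (Σℚ.foldRange-indicator (suc b) w₀ (s≤s (w≤b Fin.zero)) (λ _ → c)))) ⟩
    Σℚ.fold (boxVecs m b) (λ v → if vecEqᵇ v w then c else 0ℚ)
      ≡⟨ sum-boxVecs-indicator m b w (w≤b ∘ Fin.suc) c ⟩
    c ∎
    where
    F : Vec ℕ (suc m) → ℚ
    F lam = if vecEqᵇ lam (w₀ ∷ w) then c else 0ℚ
    first-entry : ℕ → ℚ
    first-entry a = if a ℕ.≡ᵇ w₀ then c else 0ℚ

module StaircaseSummands (n q p : ℕ) (0<p : 0 < p) (p≤q : p ≤ q) (r≤n : suc (q ∸ p) ≤ n) where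

  open import Data.Nat using (_+_)
  open BoolReflection
  open Counting
  open ShiftedDiagrams
  open StaircaseExponent
  open StaircaseShape n q p 0<p p≤q r≤n public
  open BoxEnumeration

  initial-run : ∀ R (d : ℕ → ℕ) → (∀ c → c < R → d c ≤ 1) → (∀ c → suc c < R → d (suc c) ≡ 1 → d c ≡ 1) →
    Σ ℕ (λ k → k ≤ R × (∀ c → c < R → d c ≡ below k c))
  initial-run zero d _ _ = 0 , z≤n , (λ c ())
  initial-run (suc R) d d≤1 closed
    with initial-run R d (λ c c<R → d≤1 c (ℕP.<-trans c<R (ℕP.n<1+n R))) (λ c c+1<R → closed c (ℕP.<-trans c+1<R (ℕP.n<1+n R)))
  ... | k , k≤R , d≡below with d R in dR | d≤1 R (ℕP.n<1+n R)
  ... | zero | _ = k , ℕP.m≤n⇒m≤1+n k≤R , extend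
    where
    extend : ∀ c → c < suc R → d c ≡ below k c
    extend c c<R+1 with ℕP.m≤n⇒m<n∨m≡n (ℕP.≤-pred c<R+1)
    ... | inj₁ c<R = d≡below c c<R
    ... | inj₂ refl = trans dR (sym (below-≮ k c (ℕP.≤⇒≯ k≤R)))
  ... | suc zero | _ = suc R , ℕP.≤-refl , λ c c<R+1 → trans (all-ones (R ∸ c) c (ℕP.m+[n∸m]≡n (ℕP.≤-pred c<R+1)))
                                                              (sym (below-< (suc R) c c<R+1))
    where
    all-ones : ∀ m c → c + m ≡ R → d c ≡ 1
    all-ones zero c c+0≡R = trans (cong d (trans (sym (ℕP.+-identityʳ c)) c+0≡R)) dR
    all-ones (suc m) c c+m+1≡R =
      closed c (s≤s (subst (suc c ≤_) c+m+1≡R (subst (suc c ≤_) (sym (ℕP.+-suc c m)) (s≤s (ℕP.m≤m+n c m)))))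
               (all-ones m (suc c) (trans (sym (ℕP.+-suc c m)) c+m+1≡R))
  ... | suc (suc _) | s≤s ()

  lookupℕ : ∀ {m} → Vec ℕ m → ℕ → ℕ
  lookupℕ [] c = 0
  lookupℕ (a ∷ v) zero = a
  lookupℕ (a ∷ v) (suc c) = lookupℕ v c

  lookupℕ-toℕ : ∀ {m} (v : Vec ℕ m) (i : Fin m) → lookup v i ≡ lookupℕ v (toℕ i)
  lookupℕ-toℕ (a ∷ v) Fin.zero = refl
  lookupℕ-toℕ (a ∷ v) (Fin.suc i) = lookupℕ-toℕ v i

  module Classification (lam : Vec ℕ n) (valid : validᵇ μ lam ≡ true) where

    private
      b₁ = isStrictᵇ lam
      b₂ = subᵇ μ lam
      b₃ = does (len lam ℕ.≟ len μ)
      b₄ = verticalStripᵇ lam μ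

    strict : IsStrict lam
    strict = isStrictᵇ⇒ lam (∧-elimˡ {b₁} {b₂ ∧ b₃ ∧ b₄} valid)

    μ≤λ : ∀ i → lookup μ i ≤ lookup lam i
    μ≤λ i = ≤?-true⁻ (and-allFin⁻ n _ (∧-elimˡ {b₂} {b₃ ∧ b₄} (∧-elimʳ {b₁} valid)) i)

    len-λ : len lam ≡ r
    len-λ = trans (does-true⇒ (len lam ℕ.≟ len μ) (∧-elimˡ {b₃} {b₄} (∧-elimʳ {b₂} (∧-elimʳ {b₁} valid)))) len-μ

    λ∸μ≤1 : ∀ i → lookup lam i ∸ lookup μ i ≤ 1
    λ∸μ≤1 i = subst (_≤ 1) (rowCount≡∸ lam μ i (μ≤λ i))
                     (≤?-true⁻ (and-allFin⁻ n _ (∧-elimʳ {b₃} (∧-elimʳ {b₂} (∧-elimʳ {b₁} valid))) i))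

    isNonzero : Fin n → ℕ
    isNonzero i = if not (does (lookup lam i ℕ.≟ 0)) then 1 else 0

    -- Rows below r are nonzero since μ ≤ λ there, so a further nonzero row would make ℓ(λ) > r.
    zero-from : ∀ i → ¬ toℕ i < r → lookup lam i ≡ 0
    zero-from i₀ i₀≮r with lookup lam i₀ ℕ.≟ 0
    ... | yes λᵢ≡0 = λᵢ≡0
    ... | no λᵢ≢0 = ⊥-elim (ℕP.<-irrefl refl (ℕP.≤-trans r+1≤count (ℕP.≤-reflexive count≡r)))
      where
      c₀ = toℕ i₀
      isNonzero-1 : ∀ i → lookup lam i ≢ 0 → isNonzero i ≡ 1
      isNonzero-1 i ne = if-true (not (does (lookup lam i ℕ.≟ 0))) (not-intro (dec-false (lookup lam i ℕ.≟ 0) ne))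
      count≡r : Σℕ.foldFin isNonzero ≡ r
      count≡r = trans (sym (trans (length-filterᵇ _ (allFin n)) (Σℕ.fold-allFin n isNonzero))) len-λ
      bound : ∀ i → below r (toℕ i) + (if toℕ i ℕ.≡ᵇ c₀ then 1 else 0) ≤ isNonzero i
      bound i with toℕ i ℕ.<? r
      ... | yes i<r = ℕP.≤-reflexive (trans
            (cong₂ _+_ (below-< r (toℕ i) i<r) (if-false (toℕ i ℕ.≡ᵇ c₀) (≢⇒≡ᵇ-false (toℕ i) c₀ (λ e → i₀≮r (subst (_< r) e i<r)))))
            (sym (isNonzero-1 i (λ λᵢ≡0 → ℕP.<⇒≢ (e-pos (toℕ i) i<r)
                   (sym (ℕP.n≤0⇒n≡0 (subst (e (toℕ i) ≤_) λᵢ≡0 (subst (_≤ lookup lam i) (lookup-μ i) (μ≤λ i)))))))))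
      ... | no i≮r with toℕ i ℕ.≟ c₀
      ...   | yes i≡i₀ = ℕP.≤-reflexive (trans
              (cong₂ _+_ (below-≮ r (toℕ i) i≮r) (if-true (toℕ i ℕ.≡ᵇ c₀) (trans (cong (ℕ._≡ᵇ c₀) i≡i₀) (≡ᵇ-refl c₀))))
              (sym (isNonzero-1 i (λ λᵢ≡0 → λᵢ≢0 (trans (cong (lookup lam) (FinP.toℕ-injective (sym i≡i₀))) λᵢ≡0)))))
      ...   | no i≢i₀ = ℕP.≤-trans (ℕP.≤-reflexive (cong₂ _+_ (below-≮ r (toℕ i) i≮r) (if-false (toℕ i ℕ.≡ᵇ c₀) (≢⇒≡ᵇ-false (toℕ i) c₀ i≢i₀)))) z≤n
      r+1≤count : suc r ≤ Σℕ.foldFin isNonzero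
      r+1≤count = ℕP.≤-trans (ℕP.≤-reflexive (sym lhs≡r+1)) (foldFin-+-mono _ isNonzero bound)
        where
        lhs≡r+1 : Σℕ.foldFin {n} (λ i → below r (toℕ i) + (if toℕ i ℕ.≡ᵇ c₀ then 1 else 0)) ≡ suc r
        lhs≡r+1 = trans (Σℕ.foldFin-∙ n _ _)
                        (trans (cong₂ _+_ (trans (Σℕ.foldFin-prefix n r r≤n 1) (foldRange-1 r))
                                          (Σℕ.foldFin-indicator n c₀ (FinP.toℕ<n i₀) (λ _ → 1)))
                               (ℕP.+-comm r 1))

    at : ∀ c → c < r → Fin n
    at c c<r = fromℕ< (ℕP.<-≤-trans c<r r≤n)

    toℕ-at : ∀ c (c<r : c < r) → toℕ (at c c<r) ≡ c
    toℕ-at c c<r = FinP.toℕ-fromℕ< (ℕP.<-≤-trans c<r r≤n)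

    lookup-at : ∀ c (c<r : c < r) → lookup lam (at c c<r) ≡ lookupℕ lam c
    lookup-at c c<r = trans (lookupℕ-toℕ lam (at c c<r)) (cong (lookupℕ lam) (toℕ-at c c<r))

    μ-at : ∀ c (c<r : c < r) → lookup μ (at c c<r) ≡ e c
    μ-at c c<r = trans (lookup-μ (at c c<r)) (cong e (toℕ-at c c<r))

    added : ℕ → ℕ
    added c = lookupℕ lam c ∸ e c

    added≤1 : ∀ c → c < r → added c ≤ 1
    added≤1 c c<r = subst (_≤ 1) (cong₂ _∸_ (lookup-at c c<r) (μ-at c c<r)) (λ∸μ≤1 (at c c<r))

    e≤λ : ∀ c → c < r → e c ≤ lookupℕ lam c
    e≤λ c c<r = subst₂ _≤_ (μ-at c c<r) (lookup-at c c<r) (μ≤λ (at c c<r))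

    -- If row c + 1 gained a box, then λ_{c+1} = μ_c, and strictness forces λ_c > μ_c.
    added-closed : ∀ c → suc c < r → added (suc c) ≡ 1 → added c ≡ 1
    added-closed c c+1<r added≡1 = ℕP.≤-antisym (added≤1 c c<r) (ℕP.m<n⇒0<n∸m e<λ)
      where
      c<r = ℕP.<-trans (ℕP.n<1+n c) c+1<r
      λ-next : lookupℕ lam (suc c) ≡ e c
      λ-next = trans (sym (ℕP.m+[n∸m]≡n (e≤λ (suc c) c+1<r)))
                     (trans (cong (e (suc c) +_) added≡1) (trans (ℕP.+-comm (e (suc c)) 1) (sym (staircaseExp-step c r≤q c+1<r))))
      e<λ : e c < lookupℕ lam c
      e<λ with strict (at c c<r) (at (suc c) c+1<r) (trans (cong suc (toℕ-at c c<r)) (sym (toℕ-at (suc c) c+1<r)))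
      ... | inj₁ λ≡0 = ⊥-elim (ℕP.<⇒≢ (e-pos c c<r) (sym (trans (sym λ-next) (trans (sym (lookup-at (suc c) c+1<r)) λ≡0))))
      ... | inj₂ λ-dec = subst₂ _<_ (trans (lookup-at (suc c) c+1<r) λ-next) (lookup-at c c<r) λ-dec

    is-raise : Σ ℕ (λ k → k ≤ r × lam ≡ raise k)
    is-raise with initial-run r added added≤1 added-closed
    ... | k , k≤r , added≡below = k , k≤r , trans (sym (VecP.tabulate∘lookup lam)) (VecP.tabulate-cong entry)
      where
      entry : ∀ i → lookup lam i ≡ e (toℕ i) + below k (toℕ i)
      entry i with toℕ i ℕ.<? r
      ... | yes i<r = trans (lookupℕ-toℕ lam i)
            (trans (sym (ℕP.m+[n∸m]≡n (subst (e (toℕ i) ≤_) (lookupℕ-toℕ lam i) (subst (_≤ lookup lam i) (lookup-μ i) (μ≤λ i)))))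
                   (cong (e (toℕ i) +_) (added≡below (toℕ i) i<r)))
      ... | no i≮r = trans (zero-from i i≮r)
            (sym (cong₂ _+_ (staircaseExp-≮ q i≮r) (below-≮ k (toℕ i) (λ i<k → i≮r (ℕP.<-≤-trans i<k k≤r)))))

  raise-distinct : ∀ {k k′} → k < k′ → k′ ≤ r → raise k ≢ raise k′
  raise-distinct {k} {k′} k<k′ k′≤r eq =
    ℕP.1+n≢n (sym (ℕP.+-cancelˡ-≡ (e k) _ _ (trans (sym at-k) (trans (cong (λ w → lookup w i) eq) at-k′))))
    where
    k<n = ℕP.<-≤-trans (ℕP.<-≤-trans k<k′ k′≤r) r≤n
    i = fromℕ< k<n
    at-k : lookup (raise k) i ≡ e k + 0
    at-k = trans (lookup-raise k i) (cong₂ (λ c d → e c + d) (FinP.toℕ-fromℕ< k<n)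
              (trans (cong (below k) (FinP.toℕ-fromℕ< k<n)) (below-≮ k k (ℕP.<-irrefl refl))))
    at-k′ : lookup (raise k′) i ≡ e k + 1
    at-k′ = trans (lookup-raise k′ i) (cong₂ (λ c d → e c + d) (FinP.toℕ-fromℕ< k<n)
              (trans (cong (below k′) (FinP.toℕ-fromℕ< k<n)) (below-< k′ k k<k′)))

  raise-injective : ∀ k k′ → k ≤ r → k′ ≤ r → raise k ≡ raise k′ → k ≡ k′
  raise-injective k k′ k≤r k′≤r eq with ℕP.<-cmp k k′
  ... | tri< k<k′ _ _ = ⊥-elim (raise-distinct k<k′ k′≤r eq)
  ... | tri≈ _ k≡k′ _ = k≡k′
  ... | tri> _ _ k′<k = ⊥-elim (raise-distinct k′<k k≤r (sym eq))

  raise-bounded : ∀ k i → lookup (raise k) i ≤ suc (Vec.sum μ)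
  raise-bounded k i = ℕP.≤-trans (ℕP.≤-reflexive (lookup-raise k i))
    (ℕP.≤-trans (ℕP.+-mono-≤ e≤sum (below≤1 k (toℕ i))) (ℕP.≤-reflexive (ℕP.+-comm (Vec.sum μ) 1)))
    where
    q≤sum : q ≤ Vec.sum μ
    q≤sum = ℕP.≤-trans (ℕP.≤-reflexive (sym (trans (lookup-μ first) e-first))) (lookup≤sum μ first)
    e≤sum : e (toℕ i) ≤ Vec.sum μ
    e≤sum with toℕ i ℕ.<? r
    ... | yes i<r = ℕP.≤-trans (ℕP.≤-reflexive (staircaseExp-< q i<r)) (ℕP.≤-trans (ℕP.m∸n≤m q (toℕ i)) q≤sum)
    ... | no i≮r = ℕP.≤-trans (ℕP.≤-reflexive (staircaseExp-≮ q i≮r)) z≤n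

  valid-as-indicators : ∀ (f : Vec ℕ n → ℚ) lam →
    (if validᵇ μ lam then f lam else 0ℚ) ≡ Σℚ.foldRange (suc r) (λ k → if vecEqᵇ lam (raise k) then f (raise k) else 0ℚ)
  valid-as-indicators f lam with validᵇ μ lam in valid
  ... | true with Classification.is-raise lam valid
  ...   | k₀ , k₀≤r , refl = sym (trans
          (Σℚ.foldRange-cong (suc r) (λ k k<r+1 → cong (λ b → if b then f (raise k) else 0ℚ) (eq⇔ k (ℕP.≤-pred k<r+1))))
          (Σℚ.foldRange-indicator (suc r) k₀ (s≤s k₀≤r) (λ k → f (raise k))))
    where
    eq⇔ : ∀ k → k ≤ r → vecEqᵇ (raise k₀) (raise k) ≡ (k ℕ.≡ᵇ k₀)
    eq⇔ k k≤r = bool-ext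
      (λ eq → subst (λ z → (z ℕ.≡ᵇ k₀) ≡ true) (raise-injective k₀ k k₀≤r k≤r (vecEqᵇ⇒≡ _ _ eq)) (≡ᵇ-refl k₀))
      (λ eq → subst (λ z → vecEqᵇ (raise k₀) (raise z) ≡ true) (sym (≡ᵇ-true⇒≡ k k₀ eq)) (vecEqᵇ-refl (raise k₀)))
  valid-as-indicators f lam | false = sym (trans
    (Σℚ.foldRange-cong (suc r) (λ k k<r+1 → cong (λ b → if b then f (raise k) else 0ℚ) (not-raise k (ℕP.≤-pred k<r+1))))
    (Σℚ.foldRange-ε (suc r)))
    where
    not-raise : ∀ k → k ≤ r → vecEqᵇ lam (raise k) ≡ false
    not-raise k k≤r = ≢⇒vecEqᵇ-false lam (raise k) (λ lam≡raise → contradiction (trans (sym (cong (validᵇ μ) lam≡raise)) valid))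
      where
      contradiction : validᵇ μ (raise k) ≡ false → ⊥
      contradiction invalid with trans (sym invalid) (raise-valid k k≤r)
      ... | ()

  sum-summands : ∀ (f : Vec ℕ n → ℚ) → sumℚ (summands μ) f ≡ Σℚ.foldRange (suc r) (λ k → f (raise k))
  sum-summands f = begin
    Σℚ.fold (filterᵇ (validᵇ μ) box) f
      ≡⟨ Σℚ.fold-filterᵇ (validᵇ μ) box f ⟩
    Σℚ.fold box (λ lam → if validᵇ μ lam then f lam else 0ℚ)
      ≡⟨ Σℚ.fold-cong box (valid-as-indicators f) ⟩
    Σℚ.fold box (λ lam → Σℚ.foldRange (suc r) (λ k → if vecEqᵇ lam (raise k) then f (raise k) else 0ℚ))
      ≡⟨ Σℚ.fold-foldRange-comm box (suc r) (λ lam k → if vecEqᵇ lam (raise k) then f (raise k) else 0ℚ) ⟩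
    Σℚ.foldRange (suc r) (λ k → Σℚ.fold box (λ lam → if vecEqᵇ lam (raise k) then f (raise k) else 0ℚ))
      ≡⟨ Σℚ.foldRange-cong (suc r) (λ k _ → sum-boxVecs-indicator n (suc (Vec.sum μ)) (raise k) (raise-bounded k) (f (raise k))) ⟩
    Σℚ.foldRange (suc r) (λ k → f (raise k)) ∎
    where
    box = boxVecs n (suc (Vec.sum μ))
    open ≡-Reasoning

module StaircaseIdentity (n q p : ℕ) (0<p : 0 < p) (p≤q : p ≤ q) (r≤n : suc (q ∸ p) ≤ n)
  (β : ℚ) (x : Fin n → ℚ) (x-injective : ∀ i j → i ≢ j → x i ≢ x j) (1+βx≢0 : ∀ j → 1ℚ ℚ.+ β ℚ.* x j ≢ 0ℚ) where

  open import Data.Rational using (_+_; _*_; _-_; -_)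
  open RationalFacts
  open RowFactors
  open StaircaseSummands n q p 0<p p≤q r≤n public
  open StaircaseExpansion n r β x x-injective 1+βx≢0 r≤n q r≤q public
  open ≡-Reasoning

  ι : ℚ
  ι = 1ℚ ÷' fromℕ (r ℕ.!)

  factors-2+βx : ℕ → (Fin n → ℚ) → ℚ
  factors-2+βx m y = prodℚ (allFin n) (λ i → if does (toℕ i ℕ.<? m) then fromℕ 2 + β * y i else 1ℚ)

  A-at-r : ∀ lam → maxNZ lam ≡ r → A β lam x ≡ S (λ y → mono y lam) * ι
  A-at-r lam maxNZ≡r = trans (cong (λ m → symmetrize m (λ y → mono y lam * kernel β m y) x) maxNZ≡r)
                             (÷'-≡-*-÷' (S (λ y → mono y lam)) (fromℕ (r ℕ.!)))

  B-at-r : ∀ lam → maxNZ lam ≡ r → B β lam x ≡ S (λ y → mono y lam * factors-2+βx r y) * ι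
  B-at-r lam maxNZ≡r = trans (cong (λ m → symmetrize m (λ y → mono y lam * factors-2+βx m y * kernel β m y) x) maxNZ≡r)
                             (÷'-≡-*-÷' (S (λ y → mono y lam * factors-2+βx r y)) (fromℕ (r ℕ.!)))

  pow-+-indicator : ∀ z m (b : Bool) → pow z (m ℕ.+ (if b then 1 else 0)) ≡ pow z m * (if b then z else 1ℚ)
  pow-+-indicator z zero true = ℚP.*-comm z 1ℚ
  pow-+-indicator z zero false = refl
  pow-+-indicator z (suc m) b = trans (cong (z *_) (pow-+-indicator z m b)) (sym (ℚP.*-assoc z (pow z m) _))

  mono-μ : ∀ y → mono y μ ≡ rowProd xμ y
  mono-μ y = trans (Πℚ.fold-allFin n _) (Πℚ.foldFin-cong (λ i → cong (pow (y i)) (lookup-μ i)))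

  mono-raise : ∀ k y → mono y (raise k) ≡ rowProd (xμ ⊛ xRange 0 k) y
  mono-raise k y = trans (Πℚ.fold-allFin n _) (Πℚ.foldFin-cong (λ i → begin
    pow (y i) (lookup (raise k) i)                     ≡⟨ cong (pow (y i)) (lookup-raise k i) ⟩
    pow (y i) (e (toℕ i) ℕ.+ below k (toℕ i))          ≡⟨ pow-+-indicator (y i) (e (toℕ i)) (does (toℕ i ℕ.<? k)) ⟩
    xμ (toℕ i) (y i) * (if does (toℕ i ℕ.<? k) then y i else 1ℚ)
      ≡⟨ cong (xμ (toℕ i) (y i) *_) (sym (onRange-from-0 k id (toℕ i) (y i))) ⟩
    xμ (toℕ i) (y i) * xRange 0 k (toℕ i) (y i)        ∎))

  factors-2+βx≡ : ∀ y → factors-2+βx r y ≡ pow two r * rowProd (tailFactors 0 r) y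
  factors-2+βx≡ y = begin
    factors-2+βx r y
      ≡⟨ Πℚ.fold-allFin n _ ⟩
    Πℚ.foldFin (λ i → if does (toℕ i ℕ.<? r) then fromℕ 2 + β * y i else 1ℚ)
      ≡⟨ Πℚ.foldFin-cong (λ i → trans (2+βz≡ (does (toℕ i ℕ.<? r)) (y i))
                                      (cong ((if does (toℕ i ℕ.<? r) then two else 1ℚ) *_) (sym (onRange-from-0 r (λ z → 1ℚ - t * z) (toℕ i) (y i))))) ⟩
    Πℚ.foldFin (λ i → (if does (toℕ i ℕ.<? r) then two else 1ℚ) * tailFactors 0 r (toℕ i) (y i))
      ≡⟨ Πℚ.foldFin-∙ n _ _ ⟩
    Πℚ.foldFin {n} (λ i → if does (toℕ i ℕ.<? r) then two else 1ℚ) * rowProd (tailFactors 0 r) y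
      ≡⟨ cong (_* rowProd (tailFactors 0 r) y) (trans (Πℚ.foldFin-prefix n r r≤n two) (prodRange-const r two)) ⟩
    pow two r * rowProd (tailFactors 0 r) y ∎
    where
    2+βz≡ : ∀ b z → (if b then fromℕ 2 + β * z else 1ℚ) ≡ (if b then two else 1ℚ) * (if b then 1ℚ - t * z else 1ℚ)
    2+βz≡ true z = trans (cong (λ w → fromℕ 2 + w * z) β≡-2t)
                         (solve 2 (λ t z → con two :+ (:- (con two :* t)) :* z := con two :* (con 1ℚ :- t :* z)) refl t z)
    2+βz≡ false z = refl

  B-staircase : B β μ x ≡ pow two r * T (xμ ⊛ tailFactors 0 r) * ι
  B-staircase = begin
    B β μ x
      ≡⟨ B-at-r μ maxNZ-μ ⟩
    S (λ y → mono y μ * factors-2+βx r y) * ι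
      ≡⟨ cong (_* ι) (S-cong (λ y → mono y μ * factors-2+βx r y) (λ y → pow two r * rowProd (xμ ⊛ tailFactors 0 r) y) (λ y → begin
           mono y μ * factors-2+βx r y
             ≡⟨ cong₂ _*_ (mono-μ y) (factors-2+βx≡ y) ⟩
           rowProd xμ y * (pow two r * rowProd (tailFactors 0 r) y)
             ≡⟨ solve 3 (λ a P b → a :* (P :* b) := P :* (a :* b)) refl (rowProd xμ y) (pow two r) (rowProd (tailFactors 0 r) y) ⟩
           pow two r * (rowProd xμ y * rowProd (tailFactors 0 r) y)
             ≡⟨ cong (pow two r *_) (sym (rowProd-⊛ xμ (tailFactors 0 r) y)) ⟩
           pow two r * rowProd (xμ ⊛ tailFactors 0 r) y ∎)) ⟩
    S (λ y → pow two r * rowProd (xμ ⊛ tailFactors 0 r) y) * ι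
      ≡⟨ cong (_* ι) (S-*ˡ (pow two r) (rowProd (xμ ⊛ tailFactors 0 r))) ⟩
    pow two r * T (xμ ⊛ tailFactors 0 r) * ι ∎

  A-raise : ∀ k → k ≤ r → A β (raise k) x ≡ T (xμ ⊛ xRange 0 k) * ι
  A-raise k k≤r = trans (A-at-r (raise k) (maxNZ-raise k k≤r))
                        (cong (_* ι) (S-cong (λ y → mono y (raise k)) (rowProd (xμ ⊛ xRange 0 k)) (mono-raise k)))

  corrections : ℚ
  corrections = Σℚ.foldRange r (λ k → pow t (suc k) * T (xμ ⊛ xRange 0 (suc k)))

  summand : Vec ℕ n → ℚ
  summand lam = pow (- 1ℚ) (cols lam μ) * pow t (skewSize lam μ) * A β lam x

  sum-summand-raise : Σℚ.foldRange (suc r) (λ k → summand (raise k))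
    ≡ (T xμ - corrections) * ι
  sum-summand-raise = begin
    summand (raise 0) + Σℚ.foldRange r (λ k → summand (raise (suc k)))
      ≡⟨ cong₂ _+_ first-summand (trans (Σℚ.foldRange-cong r later-summand)
                                        (sumRange-*ˡ r (- ι) (λ k → pow t (suc k) * T (xμ ⊛ xRange 0 (suc k))))) ⟩
    T xμ * ι + (- ι) * corrections
      ≡⟨ solve 3 (λ T0 ι C → T0 :* ι :+ (:- ι) :* C := (T0 :- C) :* ι) refl (T xμ) ι corrections ⟩
    (T xμ - corrections) * ι ∎
    where
    first-summand : summand (raise 0) ≡ T xμ * ι
    first-summand = begin
      pow (- 1ℚ) (cols (raise 0) μ) * pow t (skewSize (raise 0) μ) * A β (raise 0) x
        ≡⟨ cong₂ (λ a b → pow (- 1ℚ) a * pow t b * A β (raise 0) x) cols-raise-0 (skewSize-raise 0 z≤n) ⟩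
      1ℚ * 1ℚ * A β (raise 0) x
        ≡⟨ trans (cong (_* A β (raise 0) x) (ℚP.*-identityˡ 1ℚ)) (ℚP.*-identityˡ (A β (raise 0) x)) ⟩
      A β (raise 0) x
        ≡⟨ A-raise 0 z≤n ⟩
      T (xμ ⊛ one) * ι
        ≡⟨ cong (_* ι) (T-cong (xμ ⊛ one) xμ (λ c z → ℚP.*-identityʳ (xμ c z))) ⟩
      T xμ * ι ∎
    later-summand : ∀ k → k < r → summand (raise (suc k)) ≡ - ι * (pow t (suc k) * T (xμ ⊛ xRange 0 (suc k)))
    later-summand k k<r = begin
      pow (- 1ℚ) (cols (raise (suc k)) μ) * pow t (skewSize (raise (suc k)) μ) * A β (raise (suc k)) x
        ≡⟨ cong₂ (λ a b → pow (- 1ℚ) a * pow t b * A β (raise (suc k)) x) (cols-raise-suc k k<r) (skewSize-raise (suc k) k<r) ⟩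
      pow (- 1ℚ) 1 * pow t (suc k) * A β (raise (suc k)) x
        ≡⟨ cong (pow (- 1ℚ) 1 * pow t (suc k) *_) (A-raise (suc k) k<r) ⟩
      pow (- 1ℚ) 1 * pow t (suc k) * (T (xμ ⊛ xRange 0 (suc k)) * ι)
        ≡⟨ solve 3 (λ P Z ι → (:- con 1ℚ :* con 1ℚ) :* P :* (Z :* ι) := (:- ι) :* (P :* Z))
                   refl (pow t (suc k)) (T (xμ ⊛ xRange 0 (suc k))) ι ⟩
      - ι * (pow t (suc k) * T (xμ ⊛ xRange 0 (suc k))) ∎

open import Data.Rational using (_+_; _*_; _-_; -_)

lemma3p6 : (n : ℕ) → 0 < n → (q p : ℕ) → 0 < p → p ≤ q → suc (q ∸ p) ≤ n →
    (β : ℚ) (x : Fin n → ℚ) →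
    (∀ i j → i ≢ j → x i ≢ x j) → (∀ j → 1ℚ + β * x j ≢ 0ℚ) →
    B β (staircase n q p) x
      ≡ pow (fromℕ 2) (len (staircase n q p))
        * sumℚ (summands (staircase n q p)) (λ lam →
            pow (- 1ℚ) (cols lam (staircase n q p))
            * pow ((- β) ÷' fromℕ 2) (skewSize lam (staircase n q p))
            * A β lam x)
lemma3p6 n _ q p 0<p p≤q r≤n β x x-injective 1+βx≢0 = begin
  B β μ x                                                     ≡⟨ B-staircase ⟩
  pow two r * T (xμ ⊛ tailFactors 0 r) * ι                    ≡⟨ cong (λ w → pow two r * w * ι) expansion-from-0 ⟩
  pow two r * (T xμ - corrections) * ι                        ≡⟨ ℚP.*-assoc (pow two r) _ ι ⟩
  pow two r * ((T xμ - corrections) * ι)                      ≡⟨ cong (pow two r *_) (sym sum-summand-raise) ⟩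
  pow two r * Σℚ.foldRange (suc r) (λ k → summand (raise k))  ≡⟨ cong₂ _*_ (cong (pow two) (sym len-μ))
                                                                          (sym (sum-summands summand)) ⟩
  pow (fromℕ 2) (len μ) * sumℚ (summands μ) summand           ∎
  where
  open StaircaseIdentity n q p 0<p p≤q r≤n β x x-injective 1+βx≢0
  open RowFactors using (_⊛_)
  open ≡-Reasoning
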